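{- For every graph $G$, if $d:=2\lceil 17 \log_2 \pi(G)\rceil+1$ then $\pi(G^{(d)})\leq 5$.
   Context: All graphs are finite, simple and undirected. A path in a graph is a sequence of pairwise distinct vertices, consecutive ones adjacent. Given a vertex colouring $\phi$, a sequence $(v_1,\dots,v_{2s})$ is repetitively coloured if $\phi(v_i)=\phi(v_{s+i})$ for all $i\in\{1,\dots,s\}$; a colouring is nonrepetitive if no path is repetitively coloured. $\pi(G)$ is the minimum number of colours in a nonrepetitive colouring of $G$. For an integer $d\ge 0$, $G^{(d)}$ denotes the $d$-subdivision of $G$: each edge $vw$ is replaced by a path from $v$ to $w$ with exactly $d$ internal vertices, these paths being internally disjoint. -}

module Defs where

open import Data.Nat using (ℕ; zero; suc; _≤_; _≡ᵇ_)
open import Data.Fin using (Fin; toℕ; _<_)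
open import Data.Bool using (Bool; T; false)
open import Data.List using (List; []; _++_; map)
open import Data.Product using (Σ; Σ-syntax; ∃; ∃-syntax; _×_; _,_; proj₁; proj₂)
open import Data.Sum using (_⊎_)
open import Relation.Nullary using (¬_)
open import Relation.Binary.PropositionalEquality using (_≡_; _≢_)
open import Data.List.Relation.Unary.Linked using (Linked)
open import Data.List.Relation.Unary.Unique.Propositional using (Unique)

IsPath : {V : Set} → (V → V → Set) → List V → Set
IsPath Adj xs = Unique xs × Linked Adj xs

-- (v_1,…,v_2s), s ≥ 1, with φ(v_i) = φ(v_{s+i}) for all i:
-- the sequence splits as ys ++ zs with ys nonempty and equal colour
-- sequences on both halves (this forces |ys| = |zs| = s).
Repetitive : {V C : Set} → (V → C) → List V → Set
Repetitive φ xs =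
  ∃[ ys ] ∃[ zs ] (xs ≡ ys ++ zs × ys ≢ [] × map φ ys ≡ map φ zs)

Nonrepetitive : {V C : Set} → (V → V → Set) → (V → C) → Set
Nonrepetitive Adj φ = ∀ xs → IsPath Adj xs → ¬ Repetitive φ xs

HasNonrepColouring : {V : Set} → (V → V → Set) → ℕ → Set
HasNonrepColouring {V} Adj k = Σ (V → Fin k) (Nonrepetitive Adj)

IsPi : {V : Set} → (V → V → Set) → ℕ → Set
IsPi Adj p = HasNonrepColouring Adj p × (∀ k → HasNonrepColouring Adj k → p ≤ k)

record Graph (n : ℕ) : Set where
  field
    adj        : Fin n → Fin n → Bool
    adj-sym    : ∀ u v → adj u v ≡ adj v u
    adj-irrefl : ∀ v → adj v v ≡ false

  Adj : Fin n → Fin n → Set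
  Adj u v = T (adj u v)

open Graph public

Edge : ∀ {n} → Graph n → Set
Edge {n} G = Σ[ u ∈ Fin n ] Σ[ v ∈ Fin n ] (u < v × Adj G u v)

src tgt : ∀ {n} (G : Graph n) → Edge G → Fin n
src G e = proj₁ e
tgt G e = proj₁ (proj₂ e)

data SubV {n : ℕ} (G : Graph n) (d : ℕ) : Set where
  orig  : Fin n → SubV G d
  inner : Edge G → Fin d → SubV G d

-- Directed version of the edges of G^(d): the edge e = uv (u < v) becomes
-- the path u, (e,0), (e,1), …, (e,d-1), v.
data SubArc {n : ℕ} (G : Graph n) (d : ℕ) : SubV G d → SubV G d → Set where
  direct : (e : Edge G) → d ≡ 0 → SubArc G d (orig (src G e)) (orig (tgt G e))
  first  : (e : Edge G) (k : Fin d) → toℕ k ≡ 0 →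
           SubArc G d (orig (src G e)) (inner e k)
  middle : (e : Edge G) (k k′ : Fin d) → suc (toℕ k) ≡ toℕ k′ →
           SubArc G d (inner e k) (inner e k′)
  last   : (e : Edge G) (k : Fin d) → suc (toℕ k) ≡ d →
           SubArc G d (inner e k) (orig (tgt G e))

SubAdj : ∀ {n} (G : Graph n) (d : ℕ) → SubV G d → SubV G d → Set
SubAdj G d x y = SubArc G d x y ⊎ SubArc G d y x

-- Let c be a nonrepetitive p-colouring of G and write ⌈log₂ p¹⁷⌉ = L = 2 + 3r + q with q ≤ 2, so that
-- p ≤ 2ʳ. Colour the branch vertices of G^(2L+1) with 0 and the 2L + 1 inner vertices of each edge uv with
-- a word built from Thue's square-free ternary word vtm by inserting a fourth, marker letter before some
-- letters: the markers among the first L letters encode c u in binary, those among the last L letters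
-- encode c v, and no two markers are adjacent, so the word stays square-free. A repetitively coloured path
-- avoiding the branch vertices lies inside one edge and would give a square in such a word. Otherwise its
-- branch vertices sit at the same offsets in both halves, and the L colours read next to each of them
-- (behind it, or ahead of it when the half starts too close to it; consecutive branch vertices are
-- separated by 2L + 1 inner vertices) recover its colour under c, so the branch vertices form a
-- repetitively coloured path of G. If p ≤ 1 then G has no edges and any colouring works.

module Submission where

open import Defs
open import Data.Bool using (Bool; true; false; not; _xor_; T)
open import Data.Bool.Properties using (not-¬; not-involutive; not-injective) renaming (_≟_ to _≟ᴮ_)
open import Data.Empty using (⊥; ⊥-elim)
open import Data.Fin using (Fin; #_; toℕ; fromℕ<) renaming (_≟_ to _≟ᶠ_)
open import Data.Fin.Properties using (toℕ-injective; toℕ<n; toℕ-fromℕ<; fromℕ<-toℕ; fromℕ<-cong)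
open import Data.List using (List; []; _∷_; _++_; map; length; filter; reverse; take; drop)
open import Data.List.Properties
open import Data.List.Relation.Unary.All using (All; []; _∷_)
open import Data.List.Relation.Unary.All.Properties using (++⁺)
open import Data.List.Relation.Unary.AllPairs using ([]; _∷_)
open import Data.List.Relation.Unary.Linked using (Linked; []; [-]; _∷_)
open import Data.List.Relation.Unary.Unique.Propositional using (Unique)
open import Data.Nat using (ℕ; zero; suc; pred; _+_; _*_; _∸_; _^_; _≤_; _<_; z≤n; s≤s; z<s; _≤?_; _<?_; ⌊_/2⌋; ⌈_/2⌉; _/_; _%_)
open import Data.Nat.DivMod using (m≡m%n+[m/n]*n; m%n<n)
open import Data.Nat.Induction using (<-rec)
open import Data.Nat.Logarithm using (⌈log₂_⌉; ⌈log₂⌉-mono-≤; ⌈log₂⌈n/2⌉⌉≡⌈log₂n⌉∸1; ⌈log₂2^n⌉≡n)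
open import Data.Nat.Properties hiding (_≟_)
open import Data.Nat.Tactic.RingSolver using (solve-∀)
open import Data.Product using (∃; ∃₂; _×_; _,_; proj₁; proj₂)
open import Data.Sum using (_⊎_; inj₁; inj₂)
open import Data.Unit using (⊤; tt)
open import Function using (_∘_)
open import Relation.Nullary using (¬_; ¬?; Dec; yes; no)
open import Relation.Binary.PropositionalEquality

-- Thue–Morse word

odd : ℕ → Bool
odd zero          = false
odd (suc zero)    = true
odd (suc (suc n)) = odd n

bit : Bool → ℕ
bit false = 0
bit true  = 1

double-suc : ∀ k → suc k + suc k ≡ suc (suc (k + k))
double-suc k = cong suc (+-suc k k)

odd-⌊/2⌋-digits : ∀ a → a ≡ bit (odd a) + (⌊ a /2⌋ + ⌊ a /2⌋)
odd-⌊/2⌋-digits zero          = refl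
odd-⌊/2⌋-digits (suc zero)    = refl
odd-⌊/2⌋-digits (suc (suc a)) = begin
  suc (suc a)                          ≡⟨ cong (suc ∘ suc) (odd-⌊/2⌋-digits a) ⟩
  suc (suc (bit (odd a) + (h + h)))    ≡⟨ cong suc (+-suc (bit (odd a)) (h + h)) ⟨
  suc (bit (odd a) + suc (h + h))      ≡⟨ +-suc (bit (odd a)) (suc (h + h)) ⟨
  bit (odd a) + suc (suc (h + h))      ≡⟨ cong (bit (odd a) +_) (double-suc h) ⟨
  bit (odd a) + (suc h + suc h)        ∎
  where
  open ≡-Reasoning
  h = ⌊ a /2⌋

odd-⌊/2⌋-injective : ∀ {a a′} → odd a ≡ odd a′ → ⌊ a /2⌋ ≡ ⌊ a′ /2⌋ → a ≡ a′
odd-⌊/2⌋-injective {a} {a′} o h =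
  trans (odd-⌊/2⌋-digits a) (trans (cong₂ (λ b k → bit b + (k + k)) o h) (sym (odd-⌊/2⌋-digits a′)))

data BinaryDigit : ℕ → Set where
  digit : ∀ b k → BinaryDigit (bit b + (k + k))

binaryDigit : ∀ n → BinaryDigit n
binaryDigit n = subst BinaryDigit (sym (odd-⌊/2⌋-digits n)) (digit (odd n) ⌊ n /2⌋)

-- Thue–Morse: tm n is the parity of the binary digit sum of n; the fuel f ≥ n only bounds the recursion.
thueMorseFuel : ℕ → ℕ → Bool
thueMorseFuel zero    _ = false
thueMorseFuel (suc f) n = odd n xor thueMorseFuel f ⌊ n /2⌋

tm : ℕ → Bool
tm n = thueMorseFuel n n

thueMorseFuel-zero : ∀ f → thueMorseFuel f 0 ≡ false
thueMorseFuel-zero zero    = refl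
thueMorseFuel-zero (suc f) = thueMorseFuel-zero f

n≤1+m⇒⌊n/2⌋≤m : ∀ n m → n ≤ suc m → ⌊ n /2⌋ ≤ m
n≤1+m⇒⌊n/2⌋≤m zero    m _     = z≤n
n≤1+m⇒⌊n/2⌋≤m (suc n) m n≤1+m = ≤-pred (≤-trans (⌊n/2⌋<n n) n≤1+m)

thueMorseFuel-irrelevant : ∀ f f′ n → n ≤ f → n ≤ f′ → thueMorseFuel f n ≡ thueMorseFuel f′ n
thueMorseFuel-irrelevant zero    f′      zero _ _ = sym (thueMorseFuel-zero f′)
thueMorseFuel-irrelevant (suc f) zero    zero _ _ = thueMorseFuel-zero (suc f)
thueMorseFuel-irrelevant (suc f) (suc f′) n n≤f n≤f′ =
  cong (odd n xor_) (thueMorseFuel-irrelevant f f′ ⌊ n /2⌋ (n≤1+m⇒⌊n/2⌋≤m n f n≤f) (n≤1+m⇒⌊n/2⌋≤m n f′ n≤f′))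

tm-unfold : ∀ n → tm n ≡ odd n xor tm ⌊ n /2⌋
tm-unfold zero    = refl
tm-unfold (suc n) = cong (odd (suc n) xor_)
  (thueMorseFuel-irrelevant n ⌊ suc n /2⌋ _ (n≤1+m⇒⌊n/2⌋≤m (suc n) n ≤-refl) ≤-refl)

odd-double : ∀ k → odd (k + k) ≡ false
odd-double zero    = refl
odd-double (suc k) rewrite +-suc k k = odd-double k

odd-double+1 : ∀ k → odd (suc (k + k)) ≡ true
odd-double+1 zero    = refl
odd-double+1 (suc k) rewrite +-suc k k = odd-double+1 k

⌊double+1/2⌋ : ∀ k → ⌊ suc (k + k) /2⌋ ≡ k
⌊double+1/2⌋ zero    = refl
⌊double+1/2⌋ (suc k) rewrite +-suc k k = cong suc (⌊double+1/2⌋ k)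

⌊double/2⌋ : ∀ k → ⌊ k + k /2⌋ ≡ k
⌊double/2⌋ zero    = refl
⌊double/2⌋ (suc k) rewrite +-suc k k = cong suc (⌊double/2⌋ k)

tm-digit : ∀ b k → tm (bit b + (k + k)) ≡ b xor tm k
tm-digit false k = trans (tm-unfold (k + k)) (cong₂ _xor_ (odd-double k) (cong tm (⌊double/2⌋ k)))
tm-digit true  k = trans (tm-unfold (suc (k + k))) (cong₂ _xor_ (odd-double+1 k) (cong tm (⌊double+1/2⌋ k)))

tm-double : ∀ k → tm (k + k) ≡ tm k
tm-double = tm-digit false

tm-double+1 : ∀ k → tm (suc (k + k)) ≡ not (tm k)
tm-double+1 = tm-digit true

tm-double+2 : ∀ k → tm (2 + (k + k)) ≡ tm (suc k)
tm-double+2 k = trans (cong tm (sym (double-suc k))) (tm-double (suc k))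

tm-double+3 : ∀ k → tm (3 + (k + k)) ≡ not (tm (suc k))
tm-double+3 k = trans (cong (tm ∘ suc) (sym (double-suc k))) (tm-double+1 (suc k))

tm-double+4 : ∀ k → tm (4 + (k + k)) ≡ tm (2 + k)
tm-double+4 k = trans (cong (λ x → tm (2 + x)) (sym (double-suc k))) (tm-double+2 (suc k))

not-cross : ∀ {x y z} → x ≡ not y → not x ≡ z → y ≡ z
not-cross {y = y} x≡¬y ¬x≡z = trans (sym (not-involutive y)) (trans (cong not (sym x≡¬y)) ¬x≡z)

tm-noTriple : ∀ g → tm g ≡ tm (suc g) → tm (suc g) ≡ tm (2 + g) → ⊥
tm-noTriple g e₁ e₂ with binaryDigit g
... | digit false h = not-¬ refl (trans (sym (tm-double h)) (trans e₁ (tm-double+1 h)))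
... | digit true  h = not-¬ refl (trans (sym (tm-double+2 h)) (trans e₂ (tm-double+3 h)))

-- tm i … tm (i + 2s) is an overlap axaxa of period s.
Overlap : ℕ → ℕ → Set
Overlap s i = ∀ j → j ≤ s → tm (j + i) ≡ tm (j + (s + i))

overlap-at : ∀ {s i y} → Overlap s i → s + i ≡ y → ∀ j → j ≤ s → tm (j + i) ≡ tm (j + y)
overlap-at o refl = o

xor-cancelˡ : ∀ b {x y} → b xor x ≡ b xor y → x ≡ y
xor-cancelˡ false e = e
xor-cancelˡ true  e = not-injective e

overlap-half : ∀ k b h → Overlap (k + k) (bit b + (h + h)) → Overlap k h
overlap-half k b h o j j≤k = xor-cancelˡ b (begin
  b xor tm (j + h)                       ≡⟨ tm-digit b (j + h) ⟨
  tm (bit b + ((j + h) + (j + h)))        ≡⟨ cong tm (lhs (bit b) j h) ⟨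
  tm ((j + j) + (bit b + (h + h)))        ≡⟨ o (j + j) (+-mono-≤ j≤k j≤k) ⟩
  tm ((j + j) + ((k + k) + (bit b + (h + h)))) ≡⟨ cong tm (rhs (bit b) j k h) ⟩
  tm (bit b + ((j + (k + h)) + (j + (k + h)))) ≡⟨ tm-digit b (j + (k + h)) ⟩
  b xor tm (j + (k + h))                 ∎)
  where
  open ≡-Reasoning
  lhs : ∀ c j h → (j + j) + (c + (h + h)) ≡ c + ((j + h) + (j + h))
  lhs = solve-∀
  rhs : ∀ c j k h → (j + j) + ((k + k) + (c + (h + h))) ≡ c + ((j + (k + h)) + (j + (k + h)))
  rhs = solve-∀

-- An odd period pairs positions of opposite parity, and tm (2k) = tm k, tm (2k + 1) = not (tm k) then give a triple.
overlap-odd : ∀ m i → Overlap (suc (suc m + suc m)) i → ⊥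
overlap-odd m i o with binaryDigit i
... | digit false h = tm-noTriple K
  (not-cross (trans (sym (tm-double h)) (trans (o′ 0 z≤n) (tm-double+1 K)))
             (trans (sym (tm-double+1 h)) (trans (o′ 1 (s≤s z≤n)) (tm-double+2 K))))
  (not-cross (trans (sym (tm-double+2 h)) (trans (o′ 2 (s≤s (s≤s z≤n))) (tm-double+3 K)))
             (trans (sym (tm-double+3 h)) (trans (o′ 3 3≤s) (tm-double+4 K))))
  where
  K = suc (m + h)
  3≤s = s≤s (s≤s (≤-trans (s≤s z≤n) (m≤n+m (suc m) m)))
  o′ = overlap-at o (shift m h)
    where
    shift : ∀ m h → suc (suc m + suc m) + (h + h) ≡ suc (suc (m + h) + suc (m + h))
    shift = solve-∀
... | digit true h = tm-noTriple h
  (not-cross (trans (sym (tm-double K)) (trans (sym (o′ 0 z≤n)) (tm-double+1 h)))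
             (trans (sym (tm-double+1 K)) (trans (sym (o′ 1 (s≤s z≤n))) (tm-double+2 h))))
  (not-cross (trans (sym (tm-double+2 K)) (trans (sym (o′ 2 (s≤s (s≤s z≤n)))) (tm-double+3 h)))
             (trans (sym (tm-double+3 K)) (trans (sym (o′ 3 3≤s)) (tm-double+4 h))))
  where
  K = suc (suc (m + h))
  3≤s = s≤s (s≤s (≤-trans (s≤s z≤n) (m≤n+m (suc m) m)))
  o′ = overlap-at o (shift m h)
    where
    shift : ∀ m h → suc (suc m + suc m) + suc (h + h) ≡ suc (suc (m + h)) + suc (suc (m + h))
    shift = solve-∀

tm-overlapFree : ∀ s i → 0 < s → ¬ Overlap s i
tm-overlapFree = <-rec (λ s → ∀ i → 0 < s → ¬ Overlap s i) step
  where
  step : ∀ s → (∀ {s′} → s′ < s → ∀ i → 0 < s′ → ¬ Overlap s′ i) → ∀ i → 0 < s → ¬ Overlap s i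
  step s rec i 0<s o with binaryDigit s | binaryDigit i
  step .0                 rec i () o | digit false zero    | _
  step .(suc k + suc k)   rec i _  o | digit false (suc k) | digit b h =
    rec (m<n+m (suc k) z<s) h z<s (overlap-half (suc k) b h o)
  step .1                 rec i _  o | digit true zero     | _ = tm-noTriple i (o 0 z≤n) (o 1 ≤-refl)
  step .(suc (suc m + suc m)) rec i _ o | digit true (suc m) | _ = overlap-odd m i o

-- Thue's square-free ternary word

-- Colour 0 is reserved for branch vertices, 1–3 are the letters of vtm and 4 is the marker.
Colour : Set
Colour = Fin 5

letter : Bool → Bool → Colour
letter false false = # 1
letter true  true  = # 1
letter false true  = # 2
letter true  false = # 3

letter-sync : ∀ {a b a′ b′} → letter a b ≡ letter a′ b′ → a ≡ a′ → b ≡ b′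
letter-sync {false} {false} {false} {false} _ _ = refl
letter-sync {false} {true}  {false} {true}  _ _ = refl
letter-sync {true}  {false} {true}  {false} _ _ = refl
letter-sync {true}  {true}  {true}  {true}  _ _ = refl
letter-sync {false} {false} {false} {true}  () _
letter-sync {false} {true}  {false} {false} () _
letter-sync {true}  {false} {true}  {true}  () _
letter-sync {true}  {true}  {true}  {false} () _

letter-antisync : ∀ {a b a′ b′} → letter a b ≡ letter a′ b′ → a ≢ a′ → a ≡ b × a′ ≡ b′
letter-antisync {false} {false} {true}  {true}  _ _ = refl , refl
letter-antisync {true}  {true}  {false} {false} _ _ = refl , refl
letter-antisync {false} {_}     {false} _ ne = ⊥-elim (ne refl)
letter-antisync {true}  {_}     {true}  _ ne = ⊥-elim (ne refl)
letter-antisync {false} {false} {true}  {false} () _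
letter-antisync {false} {true}  {true}  {false} () _
letter-antisync {false} {true}  {true}  {true}  () _
letter-antisync {true}  {false} {false} {false} () _
letter-antisync {true}  {false} {false} {true}  () _
letter-antisync {true}  {true}  {false} {true}  () _

vtm : ℕ → Colour
vtm n = letter (tm n) (tm (suc n))

Square : ℕ → ℕ → Set
Square s i = ∀ j → j < s → vtm (j + i) ≡ vtm (j + (s + i))

-- Along a square of vtm the two copies of tm agree everywhere or disagree everywhere.
square-sync : ∀ {s i} → Square s i → tm i ≡ tm (s + i) → Overlap s i
square-sync sq e zero    _   = e
square-sync sq e (suc j) j<s = letter-sync (sq j j<s) (square-sync sq e j (<⇒≤ j<s))

square-antisync : ∀ {s i} → Square s i → tm i ≢ tm (s + i) → ∀ j → j ≤ s → tm (j + i) ≢ tm (j + (s + i))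
square-antisync sq ne zero    _   = ne
square-antisync sq ne (suc j) j<s e with letter-antisync (sq j j<s) (square-antisync sq ne j (<⇒≤ j<s))
... | p , q = square-antisync sq ne j (<⇒≤ j<s) (trans p (trans e (sym q)))

square-antisync-impossible : ∀ s i → Square (suc s) i → tm i ≢ tm (suc s + i) → ⊥
square-antisync-impossible zero     i sq ne = ne (proj₁ (letter-antisync (sq 0 z<s) ne))
square-antisync-impossible (suc s)  i sq ne = tm-noTriple i
  (proj₁ (letter-antisync (sq 0 z<s) ne))
  (proj₁ (letter-antisync (sq 1 (s≤s (s≤s z≤n))) (square-antisync sq ne 1 (s≤s z≤n))))

vtm-squareFree : ∀ s i → ¬ Square (suc s) i
vtm-squareFree s i sq with tm i ≟ᴮ tm (suc s + i)
... | yes sync     = tm-overlapFree (suc s) i z<s (square-sync sq sync)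
... | no antisync  = square-antisync-impossible s i sq antisync

-- Marked words and edge words

SquareFree : {A : Set} → List A → Set
SquareFree w = ∀ xs ys zs → w ≡ xs ++ ys ++ ys ++ zs → ys ≡ []

reverse-≡-++ : ∀ {A : Set} {ws : List A} xs zs ys → reverse ws ≡ xs ++ zs ++ ys → ws ≡ reverse ys ++ reverse zs ++ reverse xs
reverse-≡-++ {ws = ws} xs zs ys eq = begin
  ws                                       ≡⟨ reverse-involutive ws ⟨
  reverse (reverse ws)                     ≡⟨ cong reverse eq ⟩
  reverse (xs ++ zs ++ ys)                 ≡⟨ reverse-++ xs _ ⟩
  reverse (zs ++ ys) ++ reverse xs         ≡⟨ cong (_++ reverse xs) (reverse-++ zs ys) ⟩
  (reverse ys ++ reverse zs) ++ reverse xs ≡⟨ ++-assoc (reverse ys) _ _ ⟩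
  reverse ys ++ reverse zs ++ reverse xs   ∎
  where open ≡-Reasoning

squareFree-reverse : {A : Set} {w : List A} → SquareFree w → SquareFree (reverse w)
squareFree-reverse {w = w} sf xs ys zs eq = begin
  ys                      ≡⟨ reverse-involutive ys ⟨
  reverse (reverse ys)    ≡⟨ cong reverse (sf (reverse zs) (reverse ys) (reverse xs) w≡) ⟩
  []                      ∎
  where
  open ≡-Reasoning
  w≡ : w ≡ reverse zs ++ reverse ys ++ reverse ys ++ reverse xs
  w≡ = begin
    w                                                      ≡⟨ reverse-≡-++ xs ys (ys ++ zs) eq ⟩
    reverse (ys ++ zs) ++ reverse ys ++ reverse xs         ≡⟨ cong (_++ reverse ys ++ reverse xs) (reverse-++ ys zs) ⟩
    (reverse zs ++ reverse ys) ++ reverse ys ++ reverse xs ≡⟨ ++-assoc (reverse zs) _ _ ⟩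
    reverse zs ++ reverse ys ++ reverse ys ++ reverse xs   ∎

upFrom : ℕ → ℕ → List ℕ
upFrom a zero    = []
upFrom a (suc n) = a ∷ upFrom (suc a) n

map-upFrom-split : ∀ {A : Set} (f : ℕ → A) a n xs ys → map f (upFrom a n) ≡ xs ++ ys →
                   xs ≡ map f (upFrom a (length xs)) × ∃ λ m → ys ≡ map f (upFrom (length xs + a) m)
map-upFrom-split f a n       []       ys eq = refl , n , sym eq
map-upFrom-split f a zero    (x ∷ xs) ys ()
map-upFrom-split f a (suc n) (x ∷ xs) ys eq with map-upFrom-split f (suc a) n xs ys (∷-injectiveʳ eq)
... | xs≡ , m , ys≡ = cong₂ _∷_ (sym (∷-injectiveˡ eq)) xs≡ , m , trans ys≡ (cong (λ b → map f (upFrom b m)) (+-suc (length xs) a))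

map-upFrom-pointwise : ∀ {A : Set} (f : ℕ → A) a b s → map f (upFrom a s) ≡ map f (upFrom b s) →
                       ∀ j → j < s → f (j + a) ≡ f (j + b)
map-upFrom-pointwise f a b (suc s) eq zero    _       = ∷-injectiveˡ eq
map-upFrom-pointwise f a b (suc s) eq (suc j) (s≤s j<s) =
  subst₂ (λ x y → f x ≡ f y) (+-suc j a) (+-suc j b) (map-upFrom-pointwise f (suc a) (suc b) s (∷-injectiveʳ eq) j j<s)

vtm-factor-squareFree : ∀ a n → SquareFree (map vtm (upFrom a n))
vtm-factor-squareFree a n xs []         zs eq = refl
vtm-factor-squareFree a n xs ys@(_ ∷ _) zs eq
  with map-upFrom-split vtm a n xs _ eq
... | _ , m , rest₁ with map-upFrom-split vtm (length xs + a) m ys _ (sym rest₁)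
... | ys₁ , m′ , rest₂ with map-upFrom-split vtm (length ys + (length xs + a)) m′ ys zs (sym rest₂)
... | ys₂ , _ = ⊥-elim (vtm-squareFree _ (length xs + a)
                  (map-upFrom-pointwise vtm _ _ (length ys) (trans (sym ys₁) ys₂)))

mark : Colour
mark = # 4

letter≢mark : ∀ a b → letter a b ≢ mark
letter≢mark false false ()
letter≢mark false true  ()
letter≢mark true  false ()
letter≢mark true  true  ()

vtm≢mark : ∀ n → vtm n ≢ mark
vtm≢mark n = letter≢mark (tm n) (tm (suc n))

render : List (Bool × ℕ) → List Colour
render []                 = []
render ((false , i) ∷ us) = vtm i ∷ render us
render ((true  , i) ∷ us) = mark ∷ vtm i ∷ render us

render-++ : ∀ us vs → render (us ++ vs) ≡ render us ++ render vs
render-++ []                 vs = refl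
render-++ ((false , i) ∷ us) vs = cong (vtm i ∷_) (render-++ us vs)
render-++ ((true  , i) ∷ us) vs = cong (λ w → mark ∷ vtm i ∷ w) (render-++ us vs)

render-noAdjacentMarks : ∀ us xs ys → render us ≢ xs ++ mark ∷ mark ∷ ys
render-noAdjacentMarks [] [] _ ()
render-noAdjacentMarks [] (_ ∷ _) _ ()
render-noAdjacentMarks ((false , i) ∷ us) []           _ eq = vtm≢mark i (∷-injectiveˡ eq)
render-noAdjacentMarks ((false , i) ∷ us) (_ ∷ xs)     ys eq = render-noAdjacentMarks us xs ys (∷-injectiveʳ eq)
render-noAdjacentMarks ((true  , i) ∷ us) []           _ eq = vtm≢mark i (∷-injectiveˡ (∷-injectiveʳ eq))
render-noAdjacentMarks ((true  , i) ∷ us) (_ ∷ [])     _ eq = vtm≢mark i (∷-injectiveˡ (∷-injectiveʳ eq))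
render-noAdjacentMarks ((true  , i) ∷ us) (_ ∷ _ ∷ xs) ys eq =
  render-noAdjacentMarks us xs ys (∷-injectiveʳ (∷-injectiveʳ eq))

eraseMarks : List Colour → List Colour
eraseMarks = filter (λ c → ¬? (c ≟ᶠ mark))

eraseMarks-++ : ∀ v w → eraseMarks (v ++ w) ≡ eraseMarks v ++ eraseMarks w
eraseMarks-++ = filter-++ (λ c → ¬? (c ≟ᶠ mark))

eraseMarks-vtm : ∀ i w → eraseMarks (vtm i ∷ w) ≡ vtm i ∷ eraseMarks w
eraseMarks-vtm i w = filter-accept (λ c → ¬? (c ≟ᶠ mark)) {x = vtm i} {xs = w} (vtm≢mark i)

eraseMarks-mark : ∀ w → eraseMarks (mark ∷ w) ≡ eraseMarks w
eraseMarks-mark w = filter-reject (λ c → ¬? (c ≟ᶠ mark)) {x = mark} {xs = w} (λ ¬mark → ¬mark refl)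

eraseMarks-render : ∀ us → eraseMarks (render us) ≡ map vtm (map proj₂ us)
eraseMarks-render [] = refl
eraseMarks-render ((false , i) ∷ us) = trans (eraseMarks-vtm i (render us)) (cong (vtm i ∷_) (eraseMarks-render us))
eraseMarks-render ((true  , i) ∷ us) =
  trans (eraseMarks-mark (vtm i ∷ render us)) (trans (eraseMarks-vtm i (render us)) (cong (vtm i ∷_) (eraseMarks-render us)))

eraseMarks-[] : ∀ w → eraseMarks w ≡ [] → All (_≡ mark) w
eraseMarks-[] []      _  = []
eraseMarks-[] (c ∷ w) eq with c ≟ᶠ mark
... | yes c≡mark = c≡mark ∷ eraseMarks-[] w eq
... | no  _      with eq
...   | ()

marks-square : ∀ {c w} → All (_≡ mark) (c ∷ w) → ∀ zs → ∃ λ zs′ → (c ∷ w) ++ (c ∷ w) ++ zs ≡ mark ∷ mark ∷ zs′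
marks-square (refl ∷ [])         zs = _ , refl
marks-square (refl ∷ refl ∷ _)   zs = _ , refl

-- Erasing the markers turns a square into a square of a factor of vtm, so it consists of markers only.
render-squareFree : ∀ us a n → map proj₂ us ≡ upFrom a n → SquareFree (render us)
render-squareFree us a n idx xs []          zs eq = refl
render-squareFree us a n idx xs ys@(_ ∷ _)  zs eq
  with marks-square (eraseMarks-[] ys (vtm-factor-squareFree a n (eraseMarks xs) (eraseMarks ys) (eraseMarks zs) erased)) zs
  where
  erased : map vtm (upFrom a n) ≡ eraseMarks xs ++ eraseMarks ys ++ eraseMarks ys ++ eraseMarks zs
  erased = begin
    map vtm (upFrom a n)                      ≡⟨ cong (map vtm) idx ⟨
    map vtm (map proj₂ us)                    ≡⟨ eraseMarks-render us ⟨
    eraseMarks (render us)                    ≡⟨ cong eraseMarks eq ⟩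
    eraseMarks (xs ++ ys ++ ys ++ zs)         ≡⟨ eraseMarks-++ xs _ ⟩
    eraseMarks xs ++ eraseMarks (ys ++ ys ++ zs) ≡⟨ cong (eraseMarks xs ++_) (eraseMarks-++ ys _) ⟩
    eraseMarks xs ++ eraseMarks ys ++ eraseMarks (ys ++ zs) ≡⟨ cong (λ w → eraseMarks xs ++ eraseMarks ys ++ w) (eraseMarks-++ ys zs) ⟩
    eraseMarks xs ++ eraseMarks ys ++ eraseMarks ys ++ eraseMarks zs ∎
    where open ≡-Reasoning
... | zs′ , eq′ = ⊥-elim (render-noAdjacentMarks us xs zs′ (trans eq (cong (xs ++_) eq′)))

length-upFrom : ∀ a n → length (upFrom a n) ≡ n
length-upFrom a zero    = refl
length-upFrom a (suc n) = cong suc (length-upFrom (suc a) n)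

upFrom-++ : ∀ a m n → upFrom a m ++ upFrom (m + a) n ≡ upFrom a (m + n)
upFrom-++ a zero    n = refl
upFrom-++ a (suc m) n = cong (a ∷_) (trans (cong (λ b → upFrom (suc a) m ++ upFrom b n) (sym (+-suc m a))) (upFrom-++ (suc a) m n))

upFrom-snoc : ∀ a n → upFrom a (suc n) ≡ upFrom a n ++ (n + a) ∷ []
upFrom-snoc a n = trans (cong (upFrom a) (+-comm 1 n)) (sym (upFrom-++ a n 1))

letter≢0 : ∀ a b → letter a b ≢ # 0
letter≢0 false false ()
letter≢0 false true  ()
letter≢0 true  false ()
letter≢0 true  true  ()

vtm≢0 : ∀ n → vtm n ≢ # 0
vtm≢0 n = letter≢0 (tm n) (tm (suc n))

render-nonzero : ∀ us → All (_≢ # 0) (render us)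
render-nonzero []                 = []
render-nonzero ((false , i) ∷ us) = vtm≢0 i ∷ render-nonzero us
render-nonzero ((true  , i) ∷ us) = (λ ()) ∷ vtm≢0 i ∷ render-nonzero us

2^suc : ∀ r → 2 ^ suc r ≡ 2 ^ r + 2 ^ r
2^suc r = cong (2 ^ r +_) (+-identityʳ (2 ^ r))

⌊/2⌋-<-2^ : ∀ r {a} → a < 2 ^ suc r → ⌊ a /2⌋ < 2 ^ r
⌊/2⌋-<-2^ r {a} a< = subst (⌊ a /2⌋ <_) (⌊double+1/2⌋ (2 ^ r)) (⌊n/2⌋-mono (s≤s (subst (a <_) (2^suc r) a<)))

-- The r low bits of a: bit b at unit index pair (i, i+1) puts the marker before vtm i if b = 0 and before vtm (i + 1) if b = 1.
binaryUnits : ℕ → ℕ → ℕ → List (Bool × ℕ)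
binaryUnits i zero    a = []
binaryUnits i (suc r) a = (not (odd a) , i) ∷ (odd a , suc i) ∷ binaryUnits (2 + i) r ⌊ a /2⌋

binaryUnits-indices : ∀ i r a → map proj₂ (binaryUnits i r a) ≡ upFrom i (r + r)
binaryUnits-indices i zero    a = refl
binaryUnits-indices i (suc r) a rewrite +-suc r r = cong (λ w → i ∷ suc i ∷ w) (binaryUnits-indices (2 + i) r ⌊ a /2⌋)

length-render-binaryUnits : ∀ i r a → length (render (binaryUnits i r a)) ≡ 3 * r
length-render-binaryUnits i zero    a = refl
length-render-binaryUnits i (suc r) a with odd a
... | false = trans (cong (3 +_) (length-render-binaryUnits (2 + i) r ⌊ a /2⌋)) (sym (*-suc 3 r))
... | true  = trans (cong (3 +_) (length-render-binaryUnits (2 + i) r ⌊ a /2⌋)) (sym (*-suc 3 r))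

render-binaryUnits-injective : ∀ i r {a a′} xs ys → a < 2 ^ r → a′ < 2 ^ r →
  render (binaryUnits i r a) ++ xs ≡ render (binaryUnits i r a′) ++ ys → a ≡ a′
render-binaryUnits-injective i zero    {zero} {zero} _ _ _ _ _ = refl
render-binaryUnits-injective i zero    {suc _} _ _ (s≤s ()) _ _
render-binaryUnits-injective i zero    {_} {suc _} _ _ _ (s≤s ()) _
render-binaryUnits-injective i (suc r) {a} {a′} xs ys a< a′< eq with odd a in oa | odd a′ in oa′
... | false | true  = ⊥-elim (vtm≢mark i (sym (∷-injectiveˡ eq)))
... | true  | false = ⊥-elim (vtm≢mark i (∷-injectiveˡ eq))
... | false | false = odd-⌊/2⌋-injective (trans oa (sym oa′))
  (render-binaryUnits-injective (2 + i) r xs ys (⌊/2⌋-<-2^ r a<) (⌊/2⌋-<-2^ r a′<) (∷-injectiveʳ (∷-injectiveʳ (∷-injectiveʳ eq))))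
... | true  | true  = odd-⌊/2⌋-injective (trans oa (sym oa′))
  (render-binaryUnits-injective (2 + i) r xs ys (⌊/2⌋-<-2^ r a<) (⌊/2⌋-<-2^ r a′<) (∷-injectiveʳ (∷-injectiveʳ (∷-injectiveʳ eq))))

plainUnits : ℕ → ℕ → List (Bool × ℕ)
plainUnits i m = map (false ,_) (upFrom i m)

render-plainUnits : ∀ i m → render (plainUnits i m) ≡ map vtm (upFrom i m)
render-plainUnits i zero    = refl
render-plainUnits i (suc m) = cong (vtm i ∷_) (render-plainUnits (suc i) m)

codeUnits : ℕ → ℕ → ℕ → ℕ → List (Bool × ℕ)
codeUnits i r m a = binaryUnits i r a ++ plainUnits (r + r + i) m

codeUnits-indices : ∀ i r m a → map proj₂ (codeUnits i r m a) ≡ upFrom i (r + r + m)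
codeUnits-indices i r m a = begin
  map proj₂ (binaryUnits i r a ++ plainUnits (r + r + i) m)                 ≡⟨ map-++ proj₂ (binaryUnits i r a) _ ⟩
  map proj₂ (binaryUnits i r a) ++ map proj₂ (plainUnits (r + r + i) m)    ≡⟨ cong₂ _++_ (binaryUnits-indices i r a) plain ⟩
  upFrom i (r + r) ++ upFrom (r + r + i) m                                  ≡⟨ upFrom-++ i (r + r) m ⟩
  upFrom i (r + r + m)                                                      ∎
  where
  open ≡-Reasoning
  plain : map proj₂ (plainUnits (r + r + i) m) ≡ upFrom (r + r + i) m
  plain = trans (sym (map-∘ (upFrom (r + r + i) m))) (map-id (upFrom (r + r + i) m))

render-codeUnits : ∀ i r m a → render (codeUnits i r m a) ≡ render (binaryUnits i r a) ++ map vtm (upFrom (r + r + i) m)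
render-codeUnits i r m a = trans (render-++ (binaryUnits i r a) _) (cong (render (binaryUnits i r a) ++_) (render-plainUnits (r + r + i) m))

length-render-codeUnits : ∀ i r m a → length (render (codeUnits i r m a)) ≡ 3 * r + m
length-render-codeUnits i r m a = begin
  length (render (codeUnits i r m a))                                       ≡⟨ cong length (render-codeUnits i r m a) ⟩
  length (render (binaryUnits i r a) ++ map vtm (upFrom (r + r + i) m))     ≡⟨ length-++ (render (binaryUnits i r a)) ⟩
  length (render (binaryUnits i r a)) + length (map vtm (upFrom (r + r + i) m))
    ≡⟨ cong₂ _+_ (length-render-binaryUnits i r a) (trans (length-map vtm (upFrom (r + r + i) m)) (length-upFrom (r + r + i) m)) ⟩
  3 * r + m                                                                 ∎
  where open ≡-Reasoning

render-codeUnits-injective : ∀ i r m {a a′} → a < 2 ^ r → a′ < 2 ^ r →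
                             render (codeUnits i r m a) ≡ render (codeUnits i r m a′) → a ≡ a′
render-codeUnits-injective i r m {a} {a′} a< a′< eq = render-binaryUnits-injective i r _ _ a< a′<
  (trans (sym (render-codeUnits i r m a)) (trans eq (render-codeUnits i r m a′)))

reverse-render-codeUnits : ∀ i r m a → ∃₂ λ j w → reverse (render (codeUnits i r (suc m) a)) ≡ vtm j ∷ w
reverse-render-codeUnits i r m a = m + (r + r + i) , _ , (begin
  reverse (render (codeUnits i r (suc m) a))
    ≡⟨ cong reverse (render-codeUnits i r (suc m) a) ⟩
  reverse (bits ++ map vtm (upFrom (r + r + i) (suc m)))
    ≡⟨ cong (λ w → reverse (bits ++ map vtm w)) (upFrom-snoc (r + r + i) m) ⟩
  reverse (bits ++ map vtm (upFrom (r + r + i) m ++ m + (r + r + i) ∷ []))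
    ≡⟨ cong (λ w → reverse (bits ++ w)) (map-++ vtm (upFrom (r + r + i) m) _) ⟩
  reverse (bits ++ map vtm (upFrom (r + r + i) m) ++ vtm (m + (r + r + i)) ∷ [])
    ≡⟨ cong reverse (++-assoc bits _ _) ⟨
  reverse ((bits ++ map vtm (upFrom (r + r + i) m)) ++ vtm (m + (r + r + i)) ∷ [])
    ≡⟨ reverse-++ (bits ++ _) (vtm (m + (r + r + i)) ∷ []) ⟩
  vtm (m + (r + r + i)) ∷ reverse (bits ++ map vtm (upFrom (r + r + i) m)) ∎)
  where
  open ≡-Reasoning
  bits = render (binaryUnits i r a)

take-length-++ : ∀ {A : Set} (xs ys : List A) → take (length xs) (xs ++ ys) ≡ xs
take-length-++ []       ys = refl
take-length-++ (x ∷ xs) ys = cong (x ∷_) (take-length-++ xs ys)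

take-++ˡ : ∀ {A : Set} m (xs ys : List A) → m ≤ length xs → take m (xs ++ ys) ≡ take m xs
take-++ˡ zero    xs       ys _         = refl
take-++ˡ (suc m) (x ∷ xs) ys (s≤s m≤) = cong (x ∷_) (take-++ˡ m xs ys m≤)

-- Reading L letters from either end of word a b recovers the colour of that end.
record EdgeWords (k L : ℕ) : Set where
  field
    word            : Fin k → Fin k → List Colour
    length-word     : ∀ a b → length (word a b) ≡ 2 * L + 1
    word-squareFree : ∀ a b → SquareFree (word a b)
    word-nonzero    : ∀ a b → All (_≢ # 0) (word a b)
    head-injective  : ∀ {a b a′ b′} → take L (word a b) ≡ take L (word a′ b′) → a ≡ a′
    tail-injective  : ∀ {a b a′ b′} → take L (reverse (word a b)) ≡ take L (reverse (word a′ b′)) → b ≡ b′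
    head≢tail       : ∀ {a b a′ b′} → take L (word a b) ≢ take L (reverse (word a′ b′))

-- The marker opening the prefix tells a reading from the source end apart from one from the target end.
module ThueMorseCode (r q : ℕ) where

  ℓ L : ℕ
  ℓ = suc (r + r + q)
  L = 2 + (3 * r + q)

  prefixUnits suffixUnits : ℕ → List (Bool × ℕ)
  prefixUnits a = (true , 0) ∷ codeUnits 1 r q a
  suffixUnits b = codeUnits (suc ℓ) r (2 + q) b

  prefix suffix : ℕ → List Colour
  prefix a = render (prefixUnits a)
  suffix b = render (suffixUnits b)

  edgeWord : ℕ → ℕ → List Colour
  edgeWord a b = prefix a ++ vtm ℓ ∷ suffix b

  length-prefix : ∀ a → length (prefix a) ≡ L
  length-prefix a = cong (2 +_) (length-render-codeUnits 1 r q a)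

  length-suffix : ∀ b → length (suffix b) ≡ L
  length-suffix b = trans (length-render-codeUnits (suc ℓ) r (2 + q) b) (arith r q)
    where arith : ∀ r q → 3 * r + (2 + q) ≡ 2 + (3 * r + q)
          arith = solve-∀

  length-edgeWord : ∀ a b → length (edgeWord a b) ≡ 2 * L + 1
  length-edgeWord a b = begin
    length (prefix a ++ vtm ℓ ∷ suffix b)        ≡⟨ length-++ (prefix a) ⟩
    length (prefix a) + suc (length (suffix b))  ≡⟨ cong₂ (λ m n → m + suc n) (length-prefix a) (length-suffix b) ⟩
    L + suc L                                    ≡⟨ arith L ⟩
    2 * L + 1                                    ∎
    where
    open ≡-Reasoning
    arith : ∀ n → n + suc n ≡ 2 * n + 1
    arith = solve-∀

  edgeWord-squareFree : ∀ a b → SquareFree (edgeWord a b)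
  edgeWord-squareFree a b = subst SquareFree (render-++ (prefixUnits a) ((false , ℓ) ∷ suffixUnits b))
    (render-squareFree (prefixUnits a ++ (false , ℓ) ∷ suffixUnits b) 0 _ (begin
      map proj₂ (prefixUnits a ++ (false , ℓ) ∷ suffixUnits b)
        ≡⟨ map-++ proj₂ (prefixUnits a) _ ⟩
      0 ∷ map proj₂ (codeUnits 1 r q a) ++ ℓ ∷ map proj₂ (suffixUnits b)
        ≡⟨ cong₂ (λ u w → 0 ∷ u ++ w ∷ map proj₂ (suffixUnits b)) (codeUnits-indices 1 r q a) (sym (+-identityʳ ℓ)) ⟩
      upFrom 0 ℓ ++ ℓ + 0 ∷ map proj₂ (suffixUnits b)
        ≡⟨ cong (λ u → upFrom 0 ℓ ++ ℓ + 0 ∷ u) (trans (codeUnits-indices (suc ℓ) r (2 + q) b) (cong (λ i → upFrom (suc i) (r + r + (2 + q))) (sym (+-identityʳ ℓ)))) ⟩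
      upFrom 0 ℓ ++ upFrom (ℓ + 0) (suc (r + r + (2 + q)))
        ≡⟨ upFrom-++ 0 ℓ _ ⟩
      upFrom 0 (ℓ + suc (r + r + (2 + q))) ∎))
    where open ≡-Reasoning

  edgeWord-nonzero : ∀ a b → All (_≢ # 0) (edgeWord a b)
  edgeWord-nonzero a b = ++⁺ (render-nonzero (prefixUnits a)) (vtm≢0 ℓ ∷ render-nonzero (suffixUnits b))

  take-edgeWord : ∀ a b → take L (edgeWord a b) ≡ prefix a
  take-edgeWord a b = subst (λ n → take n (edgeWord a b) ≡ prefix a) (length-prefix a) (take-length-++ (prefix a) _)

  take-reverse-edgeWord : ∀ a b → take L (reverse (edgeWord a b)) ≡ reverse (suffix b)
  take-reverse-edgeWord a b = begin
    take L (reverse (prefix a ++ vtm ℓ ∷ suffix b))                   ≡⟨ cong (take L) (reverse-++ (prefix a) (vtm ℓ ∷ suffix b)) ⟩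
    take L (reverse (vtm ℓ ∷ suffix b) ++ reverse (prefix a))          ≡⟨ cong (λ w → take L (w ++ reverse (prefix a))) (unfold-reverse (vtm ℓ) (suffix b)) ⟩
    take L ((reverse (suffix b) ++ vtm ℓ ∷ []) ++ reverse (prefix a))  ≡⟨ cong (take L) (++-assoc (reverse (suffix b)) _ _) ⟩
    take L (reverse (suffix b) ++ vtm ℓ ∷ reverse (prefix a))          ≡⟨ cong (λ n → take n (reverse (suffix b) ++ _)) len ⟨
    take (length (reverse (suffix b))) (reverse (suffix b) ++ vtm ℓ ∷ reverse (prefix a)) ≡⟨ take-length-++ (reverse (suffix b)) _ ⟩
    reverse (suffix b)                                                 ∎
    where
    open ≡-Reasoning
    len : length (reverse (suffix b)) ≡ L
    len = trans (length-reverse (suffix b)) (length-suffix b)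

  prefix-injective : ∀ {a a′} → a < 2 ^ r → a′ < 2 ^ r → prefix a ≡ prefix a′ → a ≡ a′
  prefix-injective a< a′< eq = render-codeUnits-injective 1 r q a< a′< (∷-injectiveʳ (∷-injectiveʳ eq))

  suffix-injective : ∀ {b b′} → b < 2 ^ r → b′ < 2 ^ r → suffix b ≡ suffix b′ → b ≡ b′
  suffix-injective = render-codeUnits-injective (suc ℓ) r (2 + q)

  prefix≢reverse-suffix : ∀ a b → prefix a ≢ reverse (suffix b)
  prefix≢reverse-suffix a b eq with reverse-render-codeUnits (suc ℓ) r (suc q) b
  ... | j , _ , eq′ = vtm≢mark j (sym (∷-injectiveˡ (trans eq eq′)))

thueMorseEdgeWords : ∀ {k} r q → k ≤ 2 ^ r → EdgeWords k (2 + (3 * r + q))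
thueMorseEdgeWords {k} r q k≤ = record
  { word            = λ a b → edgeWord (toℕ a) (toℕ b)
  ; length-word     = λ a b → length-edgeWord (toℕ a) (toℕ b)
  ; word-squareFree = λ a b → edgeWord-squareFree (toℕ a) (toℕ b)
  ; word-nonzero    = λ a b → edgeWord-nonzero (toℕ a) (toℕ b)
  ; head-injective  = λ {a} {b} {a′} {b′} eq → toℕ-injective (prefix-injective (bound a) (bound a′)
      (trans (sym (take-edgeWord _ (toℕ b))) (trans eq (take-edgeWord _ (toℕ b′)))))
  ; tail-injective  = λ {a} {b} {a′} {b′} eq → toℕ-injective (suffix-injective (bound b) (bound b′)
      (reverse-injective (trans (sym (take-reverse-edgeWord (toℕ a) _)) (trans eq (take-reverse-edgeWord (toℕ a′) _)))))
  ; head≢tail       = λ {a} {b} {a′} {b′} eq → prefix≢reverse-suffix (toℕ a) (toℕ b′)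
      (trans (sym (take-edgeWord _ (toℕ b))) (trans eq (take-reverse-edgeWord (toℕ a′) _)))
  }
  where
  open ThueMorseCode r q
  bound : (a : Fin k) → toℕ a < 2 ^ r
  bound a = <-≤-trans (toℕ<n a) k≤

-- Walks in a subdivision

data Comparable {A : Set} : List A → List A → Set where
  []ˡ : ∀ {ys} → Comparable [] ys
  []ʳ : ∀ {xs} → Comparable xs []
  _∷_ : ∀ x {xs ys} → Comparable xs ys → Comparable (x ∷ xs) (x ∷ ys)

comparable-take : ∀ {A : Set} {xs ys : List A} n → Comparable xs ys → n ≤ length xs → n ≤ length ys → take n xs ≡ take n ys
comparable-take zero    _        _         _         = refl
comparable-take (suc n) (x ∷ cs) (s≤s n≤) (s≤s n≤′) = cong (x ∷_) (comparable-take n cs n≤ n≤′)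

module _ {A : Set} {P : A → Set} where

  comparable-all : ∀ {ws is o} → Comparable ws (is ++ o ∷ []) → ¬ P o → All P ws → ∃ λ vs → is ≡ ws ++ vs
  comparable-all {is = []}     (_ ∷ _)  ¬Po (Po ∷ _)   = ⊥-elim (¬Po Po)
  comparable-all {is = _ ∷ _}  (x ∷ cs) ¬Po (_ ∷ Pws)  = let vs , eq = comparable-all cs ¬Po Pws in vs , cong (x ∷_) eq
  comparable-all {is = is}     []ˡ      _   _          = is , refl

  comparable-first : ∀ ms {w ns is o} → Comparable (ms ++ w ∷ ns) (is ++ o ∷ []) → All P is → ¬ P w → ¬ P o →
                     length is ≤ length ms × (All P ms → w ≡ o)
  comparable-first []       {is = []}    (_ ∷ _)  _          _   _   = z≤n , λ _ → refl
  comparable-first []       {is = _ ∷ _} (_ ∷ _)  (Pw ∷ _)   ¬Pw _   = ⊥-elim (¬Pw Pw)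
  comparable-first (m ∷ ms) {is = []}    (_ ∷ _)  _          _   ¬Po = z≤n , λ { (Pm ∷ _) → ⊥-elim (¬Po Pm) }
  comparable-first (m ∷ ms) {is = _ ∷ _} (_ ∷ cs) (_ ∷ Pis)  ¬Pw ¬Po with comparable-first ms cs Pis ¬Pw ¬Po
  ... | is≤ms , w≡o = s≤s is≤ms , λ { (_ ∷ Pms) → w≡o Pms }

module Walks {V : Set} (_~_ : V → V → Set) where

  -- What the argument uses of a walk being a path.
  record NonBacktracking (ws : List V) : Set where
    field
      adjacent : ∀ xs x y ys → ws ≡ xs ++ x ∷ y ∷ ys → x ~ y
      distinct : ∀ xs x y z ys → ws ≡ xs ++ x ∷ y ∷ z ∷ ys → x ≢ z

  open NonBacktracking public

  adjacent-head : ∀ {x y ws} → NonBacktracking (x ∷ y ∷ ws) → x ~ y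
  adjacent-head nb = adjacent nb [] _ _ _ refl

  distinct-head : ∀ {x y z ws} → NonBacktracking (x ∷ y ∷ z ∷ ws) → x ≢ z
  distinct-head nb = distinct nb [] _ _ _ _ refl

  nonBacktracking-tail : ∀ {w ws} → NonBacktracking (w ∷ ws) → NonBacktracking ws
  nonBacktracking-tail {w} nb = record
    { adjacent = λ xs x y ys eq → adjacent nb (w ∷ xs) x y ys (cong (w ∷_) eq)
    ; distinct = λ xs x y z ys eq → distinct nb (w ∷ xs) x y z ys (cong (w ∷_) eq)
    }

  nonBacktracking-suffix : ∀ us {ws} → NonBacktracking (us ++ ws) → NonBacktracking ws
  nonBacktracking-suffix []       nb = nb
  nonBacktracking-suffix (_ ∷ us) nb = nonBacktracking-suffix us (nonBacktracking-tail nb)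

  nonBacktracking-prefix : ∀ us {ws} → NonBacktracking (us ++ ws) → NonBacktracking us
  nonBacktracking-prefix us {ws} nb = record
    { adjacent = λ xs x y ys eq → adjacent nb xs x y (ys ++ ws) (extend xs (x ∷ y ∷ ys) eq)
    ; distinct = λ xs x y z ys eq → distinct nb xs x y z (ys ++ ws) (extend xs (x ∷ y ∷ z ∷ ys) eq)
    }
    where
    extend : ∀ xs zs → us ≡ xs ++ zs → us ++ ws ≡ xs ++ zs ++ ws
    extend xs zs refl = ++-assoc xs zs ws

  module _ (~-sym : ∀ {x y} → x ~ y → y ~ x) where

    nonBacktracking-reverse : ∀ {ws} → NonBacktracking ws → NonBacktracking (reverse ws)
    nonBacktracking-reverse nb = record
      { adjacent = λ xs x y ys eq → ~-sym (adjacent nb (reverse ys) y x (reverse xs) (reverse-≡-++ xs (x ∷ y ∷ []) ys eq))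
      ; distinct = λ xs x y z ys eq x≡z →
          distinct nb (reverse ys) z y x (reverse xs) (reverse-≡-++ xs (x ∷ y ∷ z ∷ []) ys eq) (sym x≡z)
      }

  path⇒nonBacktracking : ∀ {ws} → IsPath _~_ ws → NonBacktracking ws
  path⇒nonBacktracking (unique , linked) = record { adjacent = adjacent-in _ linked ; distinct = distinct-in _ unique }
    where
    adjacent-in : ∀ ws → Linked _~_ ws → ∀ xs x y ys → ws ≡ xs ++ x ∷ y ∷ ys → x ~ y
    adjacent-in _ (x~y ∷ _)  []       x y ys refl = x~y
    adjacent-in _ (_ ∷ ls)   (_ ∷ xs) x y ys eq   = adjacent-in _ ls xs x y ys (∷-injectiveʳ eq)
    adjacent-in _ [-]        (_ ∷ []) x y ys ()
    adjacent-in _ [-]        (_ ∷ _ ∷ _) x y ys ()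
    distinct-in : ∀ ws → Unique ws → ∀ xs x y z ys → ws ≡ xs ++ x ∷ y ∷ z ∷ ys → x ≢ z
    distinct-in _ ((_ ∷ x≢z ∷ _) ∷ _) []       x y z ys refl = x≢z
    distinct-in _ (_ ∷ us)            (_ ∷ xs) x y z ys eq   = distinct-in _ us xs x y z ys (∷-injectiveʳ eq)

data Direction : Set where
  forward backward : Direction

module Subdivision {n : ℕ} (G : Graph n) (d : ℕ) where

  V : Set
  V = SubV G d

  _~_ : V → V → Set
  _~_ = SubAdj G d

  open Walks _~_ public

  ~-sym : ∀ {x y} → x ~ y → y ~ x
  ~-sym (inj₁ a) = inj₂ a
  ~-sym (inj₂ a) = inj₁ a

  IsInner : V → Set
  IsInner (orig _)    = ⊥
  IsInner (inner _ _) = ⊤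

  -- along e t is the t-th vertex of the subdivided edge e, counted from src e (t ≤ d + 1).
  along : Edge G → ℕ → V
  along e zero    = orig (src G e)
  along e (suc t) with t <? d
  ... | yes t<d = inner e (fromℕ< t<d)
  ... | no  _   = orig (tgt G e)

  along-suc : ∀ e t (t<d : t < d) → along e (suc t) ≡ inner e (fromℕ< t<d)
  along-suc e t t<d with t <? d
  ... | yes t<d′ = cong (inner e) (fromℕ<-cong t t refl t<d′ t<d)
  ... | no  t≮d  = ⊥-elim (t≮d t<d)

  along-inner : ∀ e (k : Fin d) → along e (suc (toℕ k)) ≡ inner e k
  along-inner e k = trans (along-suc e (toℕ k) (toℕ<n k)) (cong (inner e) (fromℕ<-toℕ k _))

  along-beyond : ∀ e t → ¬ t < d → along e (suc t) ≡ orig (tgt G e)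
  along-beyond e t t≮d with t <? d
  ... | yes t<d = ⊥-elim (t≮d t<d)
  ... | no  _   = refl

  along-end : ∀ e → along e (suc d) ≡ orig (tgt G e)
  along-end e = along-beyond e d (<-irrefl refl)

  position : Direction → Edge G → ℕ → V
  position forward  e t = along e t
  position backward e t = along e (suc d ∸ t)

  position-end : ∀ δ e → ¬ IsInner (position δ e (suc d))
  position-end forward  e = subst (λ x → ¬ IsInner x) (sym (along-end e)) λ ()
  position-end backward e = subst (λ x → ¬ IsInner x) (sym (cong (along e) (n∸n≡0 d))) λ ()

  d∸t≡suc : ∀ t → t < d → d ∸ t ≡ suc (d ∸ suc t)
  d∸t≡suc t t<d = +-∸-assoc 1 t<d

  d∸suc-t<d : ∀ t → t < d → d ∸ suc t < d
  d∸suc-t<d t t<d = subst (_≤ d) (d∸t≡suc t t<d) (m∸n≤m d t)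

  position-inner : ∀ δ e t → t < d → IsInner (position δ e (suc t))
  position-inner forward  e t t<d = subst IsInner (sym (along-suc e t t<d)) tt
  position-inner backward e t t<d =
    subst IsInner (sym (trans (cong (along e) (d∸t≡suc t t<d)) (along-suc e _ (d∸suc-t<d t t<d)))) tt

  inner-neighbours : ∀ e k z → inner e k ~ z → z ≡ along e (toℕ k) ⊎ z ≡ along e (2 + toℕ k)
  inner-neighbours e k z (inj₁ (middle .e .k k′ eq)) = inj₂ (sym (trans (cong (along e ∘ suc) eq) (along-inner e k′)))
  inner-neighbours e k z (inj₁ (last .e .k eq))      = inj₂ (sym (trans (cong (along e ∘ suc) eq) (along-end e)))
  inner-neighbours e k z (inj₂ (first .e .k eq))     = inj₁ (sym (cong (along e) eq))
  inner-neighbours e k z (inj₂ (middle .e k₀ .k eq)) = inj₁ (sym (trans (cong (along e) (sym eq)) (along-inner e k₀)))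

  along-neighbours : ∀ e t → t < d → ∀ z → along e (suc t) ~ z → z ≡ along e t ⊎ z ≡ along e (2 + t)
  along-neighbours e t t<d z x~z =
    subst (λ u → z ≡ along e u ⊎ z ≡ along e (2 + u)) (toℕ-fromℕ< t<d)
      (inner-neighbours e (fromℕ< t<d) z (subst (_~ z) (along-suc e t t<d) x~z))

  position-neighbours : ∀ δ e t → t < d → ∀ z → position δ e (suc t) ~ z →
                        z ≡ position δ e t ⊎ z ≡ position δ e (2 + t)
  position-neighbours forward  = along-neighbours
  position-neighbours backward e t t<d z x~z
    with along-neighbours e (d ∸ suc t) (d∸suc-t<d t t<d) z (subst (λ u → along e u ~ z) (d∸t≡suc t t<d) x~z)
  ... | inj₁ z≡ = inj₂ z≡
  ... | inj₂ z≡ = inj₁ (trans z≡ (cong (along e) (sym (trans (+-∸-assoc 1 (<⇒≤ t<d)) (cong suc (d∸t≡suc t t<d))))))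

  branch-neighbour : d ≢ 0 → ∀ v y → orig v ~ y → ∃₂ λ δ e → orig v ≡ position δ e 0 × y ≡ position δ e 1
  branch-neighbour d≢0 v y (inj₁ (direct e d≡0))  = ⊥-elim (d≢0 d≡0)
  branch-neighbour d≢0 v y (inj₂ (direct e d≡0))  = ⊥-elim (d≢0 d≡0)
  branch-neighbour d≢0 v y (inj₁ (first e k k≡0)) =
    forward , e , refl , sym (trans (cong (along e ∘ suc) (sym k≡0)) (along-inner e k))
  branch-neighbour d≢0 v y (inj₂ (last e k eq))   =
    backward , e , sym (along-end e) , sym (trans (cong (along e) (sym eq)) (along-inner e k))

  segment : Direction → Edge G → ℕ → ℕ → List V
  segment δ e a m = map (position δ e) (upFrom a m)

  length-segment : ∀ δ e a m → length (segment δ e a m) ≡ m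
  length-segment δ e a m = trans (length-map (position δ e) (upFrom a m)) (length-upFrom a m)

  segment-snoc : ∀ δ e a m → segment δ e a (suc m) ≡ segment δ e a m ++ position δ e (m + a) ∷ []
  segment-snoc δ e a m = trans (cong (map (position δ e)) (upFrom-snoc a m)) (map-++ (position δ e) (upFrom a m) _)

  segment-++ : ∀ δ e a m k → segment δ e a m ++ segment δ e (m + a) k ≡ segment δ e a (m + k)
  segment-++ δ e a m k = trans (sym (map-++ (position δ e) (upFrom a m) _)) (cong (map (position δ e)) (upFrom-++ a m k))

  runs-along : ∀ δ e t ws → t < d → NonBacktracking (position δ e t ∷ position δ e (suc t) ∷ ws) →
               Comparable (position δ e (suc t) ∷ ws) (segment δ e (suc t) (suc (d ∸ t)))
  runs-along δ e t []       t<d nb = _ ∷ []ˡ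
  runs-along δ e t (z ∷ ws) t<d nb
    with position-neighbours δ e t t<d z (adjacent-head (nonBacktracking-tail nb))
  ... | inj₁ refl = ⊥-elim (distinct-head nb refl)
  ... | inj₂ refl with suc t <? d
  ...   | yes t+1<d = _ ∷ subst (λ m → Comparable (position δ e (2 + t) ∷ ws) (segment δ e (2 + t) m))
                              (sym (d∸t≡suc t t<d)) (runs-along δ e (suc t) ws t+1<d (nonBacktracking-tail nb))
  ...   | no  t+1≮d = _ ∷ subst (λ m → Comparable (position δ e (2 + t) ∷ ws) (segment δ e (2 + t) m))
                              (sym d∸t≡1) (_ ∷ []ʳ)
    where
    d∸t≡1 : d ∸ t ≡ 1
    d∸t≡1 = trans (cong (_∸ t) (sym (≤-antisym t<d (≮⇒≥ t+1≮d)))) (m+n∸n≡m 1 t)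

  segment-inner : ∀ δ e t m → t + m ≤ d → All IsInner (segment δ e (suc t) m)
  segment-inner δ e t zero    _     = []
  segment-inner δ e t (suc m) t+m≤d =
    position-inner δ e t (<-≤-trans (m<m+n t z<s) t+m≤d) ∷ segment-inner δ e (suc t) m (subst (_≤ d) (+-suc t m) t+m≤d)

  track : Direction → Edge G → List V
  track δ e = segment δ e 1 d ++ position δ e (suc d) ∷ []

  track-inner : ∀ δ e → All IsInner (segment δ e 1 d)
  track-inner δ e = segment-inner δ e 0 d ≤-refl

  leaving-branch : d ≢ 0 → ∀ {v y ws} → NonBacktracking (orig v ∷ y ∷ ws) →
                 ∃₂ λ δ e → orig v ≡ position δ e 0 × Comparable (y ∷ ws) (track δ e)
  leaving-branch d≢0 {v} {y} {ws} nb with branch-neighbour d≢0 v y (adjacent-head nb)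
  ... | δ , e , v≡ , refl = δ , e , v≡ , subst (Comparable (position δ e 1 ∷ ws)) track≡
        (runs-along δ e 0 ws (n≢0⇒n>0 d≢0) (subst (λ u → NonBacktracking (u ∷ position δ e 1 ∷ ws)) v≡ nb))
    where
    track≡ : segment δ e 1 (suc d) ≡ track δ e
    track≡ = trans (segment-snoc δ e 1 d) (cong (λ t → segment δ e 1 d ++ position δ e t ∷ []) (+-comm d 1))

  orig-injective : ∀ {v w} → orig {G = G} {d = d} v ≡ orig w → v ≡ w
  orig-injective refl = refl

  edge-adjacent : ∀ δ e {v w} → position δ e 0 ≡ orig v → position δ e (suc d) ≡ orig w → Adj G v w
  edge-adjacent forward  (_ , _ , _ , a) refl w≡ = subst (Adj G _) (orig-injective (trans (sym (along-end _)) w≡)) a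
  edge-adjacent backward e@(u , u′ , _ , a) v≡ w≡ =
    subst₂ (Adj G) (orig-injective (trans (sym (along-end e)) v≡)) (orig-injective (trans (cong (along e) (sym (n∸n≡0 d))) w≡))
      (subst T (adj-sym G u u′) a)

  between-branches : d ≢ 0 → ∀ {v w} ms {ns} → NonBacktracking (orig v ∷ ms ++ orig w ∷ ns) →
                  d ≤ length ms × (All IsInner ms → Adj G v w)
  between-branches d≢0 ms nb with leaving d≢0 ms nb
    where
    leaving : d ≢ 0 → ∀ {v w} ms {ns} → NonBacktracking (orig v ∷ ms ++ orig w ∷ ns) →
              ∃₂ λ δ e → orig v ≡ position δ e 0 × Comparable (ms ++ orig w ∷ ns) (track δ e)
    leaving d≢0 []       nb = leaving-branch d≢0 nb
    leaving d≢0 (_ ∷ _)  nb = leaving-branch d≢0 nb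
  ... | δ , e , v≡ , cmp with comparable-first ms cmp (track-inner δ e) (λ ()) (position-end δ e)
  ... | d≤ , w≡ = subst (_≤ length ms) (length-segment δ e 1 d) d≤
                , λ inner → edge-adjacent δ e (sym v≡) (sym (w≡ inner))

  inner-adjacent : ∀ e k y → inner e k ~ y → IsInner y →
                   ∃₂ λ δ t → suc t < d × inner e k ≡ position δ e (suc t) × y ≡ position δ e (2 + t)
  inner-adjacent e k y x~y y-inner with inner-neighbours e k y x~y
  ... | inj₂ y≡ = onward (suc (toℕ k) <? d)
    where
    onward : Dec (suc (toℕ k) < d) →
             ∃₂ λ δ t → suc t < d × inner e k ≡ position δ e (suc t) × y ≡ position δ e (2 + t)
    onward (yes k+1<d) = forward , toℕ k , k+1<d , sym (along-inner e k) , y≡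
    onward (no  k+1≮d) = ⊥-elim (subst IsInner (trans y≡ (along-beyond e (suc (toℕ k)) k+1≮d)) y-inner)
  inner-adjacent e k y x~y y-inner | inj₁ y≡ with toℕ k in k≡
  ... | zero   = ⊥-elim (subst IsInner y≡ y-inner)
  ... | suc k₀ = backward , t , t+1<d , x≡ , trans y≡ (cong (along e) (sym d∸t+1≡))
    where
    k₀+1<d : suc k₀ < d
    k₀+1<d = subst (_< d) k≡ (toℕ<n k)
    t = d ∸ suc (suc k₀)
    d∸t≡ : d ∸ t ≡ suc (suc k₀)
    d∸t≡ = m∸[m∸n]≡n k₀+1<d
    d∸t+1≡ : d ∸ suc t ≡ suc k₀
    d∸t+1≡ = trans (sym (pred[m∸n]≡m∸[1+n] d t)) (cong pred d∸t≡)
    t+1<d : suc t < d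
    t+1<d = m∸n≢0⇒n<m (1+n≢0 ∘ trans (sym d∸t+1≡))
    x≡ : inner e k ≡ position backward e (suc t)
    x≡ = sym (trans (cong (along e) d∸t≡) (trans (cong (along e ∘ suc) (sym k≡)) (along-inner e k)))

  inner-walk-infix : ∀ {x} ws → ws ≢ [] → NonBacktracking (x ∷ ws) → All IsInner (x ∷ ws) →
                     ∃₂ λ δ e → ∃₂ λ us vs → segment δ e 1 d ≡ us ++ (x ∷ ws) ++ vs
  inner-walk-infix []       ws≢[] _ _ = ⊥-elim (ws≢[] refl)
  inner-walk-infix {inner e k} (y ∷ ws) _ nb (_ ∷ y-inner ∷ ws-inner) with inner-adjacent e k y (adjacent-head nb) y-inner
  ... | δ , t , t+1<d , x≡ , refl = δ , e , segment δ e 1 t , vs , (begin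
    segment δ e 1 d                                    ≡⟨ cong (segment δ e 1) (m+[n∸m]≡n t≤d) ⟨
    segment δ e 1 (t + (d ∸ t))                         ≡⟨ segment-++ δ e 1 t (d ∸ t) ⟨
    segment δ e 1 t ++ segment δ e (t + 1) (d ∸ t)      ≡⟨ cong (λ a → segment δ e 1 t ++ segment δ e a (d ∸ t)) (+-comm t 1) ⟩
    segment δ e 1 t ++ segment δ e (suc t) (d ∸ t)      ≡⟨ cong (segment δ e 1 t ++_) rest≡ ⟩
    segment δ e 1 t ++ (inner e k ∷ position δ e (2 + t) ∷ ws) ++ vs ∎)
    where
    open ≡-Reasoning
    t≤d : t ≤ d
    t≤d = <⇒≤ (<-trans (n<1+n t) t+1<d)
    walk = runs-along δ e (suc t) ws t+1<d (subst (λ u → NonBacktracking (u ∷ position δ e (2 + t) ∷ ws)) x≡ nb)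
    tail≡ : segment δ e (suc t) (2 + (d ∸ suc t)) ≡ segment δ e (suc t) (d ∸ t) ++ position δ e (suc d) ∷ []
    tail≡ = begin
      segment δ e (suc t) (2 + (d ∸ suc t))              ≡⟨ cong (segment δ e (suc t) ∘ suc) (d∸t≡suc t (<-trans (n<1+n t) t+1<d)) ⟨
      segment δ e (suc t) (suc (d ∸ t))                   ≡⟨ segment-snoc δ e (suc t) (d ∸ t) ⟩
      segment δ e (suc t) (d ∸ t) ++ position δ e (d ∸ t + suc t) ∷ [] ≡⟨ cong (λ a → segment δ e (suc t) (d ∸ t) ++ position δ e a ∷ []) end≡ ⟩
      segment δ e (suc t) (d ∸ t) ++ position δ e (suc d) ∷ [] ∎
      where
      end≡ : d ∸ t + suc t ≡ suc d
      end≡ = trans (+-suc (d ∸ t) t) (cong suc (m∸n+n≡m t≤d))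
    split = comparable-all (subst (Comparable (position δ e (suc t) ∷ position δ e (2 + t) ∷ ws)) tail≡ (_ ∷ walk))
              (position-end δ e) (subst IsInner x≡ tt ∷ y-inner ∷ ws-inner)
    vs = proj₁ split
    rest≡ : segment δ e (suc t) (d ∸ t) ≡ (inner e k ∷ position δ e (2 + t) ∷ ws) ++ vs
    rest≡ = trans (proj₂ split) (cong (λ u → (u ∷ position δ e (2 + t) ∷ ws) ++ vs) (sym x≡))

-- Colouring the subdivision

-- Junk value # 1 past the end of the list.
nth : List Colour → ℕ → Colour
nth []       _       = # 1
nth (x ∷ xs) zero    = x
nth (x ∷ xs) (suc t) = nth xs t

nth-nonzero : ∀ {xs} t → All (_≢ # 0) xs → nth xs t ≢ # 0
nth-nonzero t       []          ()
nth-nonzero zero    (x≢0 ∷ _)   = x≢0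
nth-nonzero (suc t) (_ ∷ xs≢0) = nth-nonzero t xs≢0

drop-nth : ∀ xs t → t < length xs → drop t xs ≡ nth xs t ∷ drop (suc t) xs
drop-nth (x ∷ xs) zero    _       = refl
drop-nth (x ∷ xs) (suc t) (s≤s t<) = drop-nth xs t t<

map-∸-upFrom-suc : ∀ k a m → map (suc k ∸_) (upFrom (suc a) m) ≡ map (k ∸_) (upFrom a m)
map-∸-upFrom-suc k a zero    = refl
map-∸-upFrom-suc k a (suc m) = cong (k ∸ a ∷_) (map-∸-upFrom-suc k (suc a) m)

reverse-upFrom : ∀ m → reverse (upFrom 1 m) ≡ map (suc m ∸_) (upFrom 1 m)
reverse-upFrom zero    = refl
reverse-upFrom (suc m) = begin
  reverse (upFrom 1 (suc m))                  ≡⟨ cong reverse (upFrom-snoc 1 m) ⟩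
  reverse (upFrom 1 m ++ m + 1 ∷ [])          ≡⟨ reverse-++ (upFrom 1 m) (m + 1 ∷ []) ⟩
  m + 1 ∷ reverse (upFrom 1 m)                ≡⟨ cong₂ _∷_ (+-comm m 1) (reverse-upFrom m) ⟩
  suc m ∷ map (suc m ∸_) (upFrom 1 m)         ≡⟨ cong (suc m ∷_) (map-∸-upFrom-suc (suc m) 1 m) ⟨
  map (suc (suc m) ∸_) (upFrom 1 (suc m))     ∎
  where open ≡-Reasoning

module SubdivisionColouring {n : ℕ} (G : Graph n) {p L : ℕ} (W : EdgeWords p L) (c : Fin n → Fin p) where

  open EdgeWords W

  d : ℕ
  d = 2 * L + 1

  open Subdivision G d

  d≢0 : d ≢ 0
  d≢0 = 1+n≢0 ∘ trans (+-comm 1 (2 * L))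

  edgeWord : Edge G → List Colour
  edgeWord e = word (c (src G e)) (c (tgt G e))

  ψ : V → Colour
  ψ (orig _)    = # 0
  ψ (inner e k) = nth (edgeWord e) (toℕ k)

  oriented : Direction → Edge G → List Colour
  oriented forward  e = edgeWord e
  oriented backward e = reverse (edgeWord e)

  forward-colours : ∀ e t m → t + m ≡ d → map ψ (segment forward e (suc t) m) ≡ drop t (edgeWord e)
  forward-colours e t zero    t≡d = sym (drop-all t (edgeWord e) (≤-reflexive (trans (length-word _ _) (trans (sym t≡d) (+-identityʳ t)))))
  forward-colours e t (suc m) t+m≡d = begin
    ψ (along e (suc t)) ∷ map ψ (segment forward e (suc (suc t)) m)  ≡⟨ cong₂ _∷_ ψ-along (forward-colours e (suc t) m (trans (sym (+-suc t m)) t+m≡d)) ⟩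
    nth (edgeWord e) t ∷ drop (suc t) (edgeWord e)                    ≡⟨ drop-nth (edgeWord e) t t<len ⟨
    drop t (edgeWord e)                                               ∎
    where
    open ≡-Reasoning
    t<d : t < d
    t<d = subst (t <_) t+m≡d (subst (_≤ t + suc m) (+-comm t 1) (+-monoʳ-≤ t (s≤s z≤n)))
    t<len : t < length (edgeWord e)
    t<len = subst (t <_) (sym (length-word _ _)) t<d
    ψ-along : ψ (along e (suc t)) ≡ nth (edgeWord e) t
    ψ-along = trans (cong ψ (along-suc e t t<d)) (cong (nth (edgeWord e)) (toℕ-fromℕ< t<d))

  segment-backward : ∀ e → segment backward e 1 d ≡ reverse (segment forward e 1 d)
  segment-backward e = begin
    map (along e ∘ (suc d ∸_)) (upFrom 1 d)     ≡⟨ map-∘ (upFrom 1 d) ⟩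
    map (along e) (map (suc d ∸_) (upFrom 1 d)) ≡⟨ cong (map (along e)) (reverse-upFrom d) ⟨
    map (along e) (reverse (upFrom 1 d))        ≡⟨ reverse-map (along e) (upFrom 1 d) ⟩
    reverse (map (along e) (upFrom 1 d))        ∎
    where open ≡-Reasoning

  track-colours : ∀ δ e → map ψ (segment δ e 1 d) ≡ oriented δ e
  track-colours forward  e = forward-colours e 0 d refl
  track-colours backward e = begin
    map ψ (segment backward e 1 d)            ≡⟨ cong (map ψ) (segment-backward e) ⟩
    map ψ (reverse (segment forward e 1 d))   ≡⟨ reverse-map ψ (segment forward e 1 d) ⟩
    reverse (map ψ (segment forward e 1 d))   ≡⟨ cong reverse (track-colours forward e) ⟩
    reverse (edgeWord e)                      ∎
    where open ≡-Reasoning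

  -- u is met on the first L vertices after leaving a branch vertex of colour a.
  Reads : Fin p → List Colour → Set
  Reads a u = (∃ λ b → u ≡ take L (word a b)) ⊎ (∃ λ b → u ≡ take L (reverse (word b a)))

  reads-injective : ∀ {a a′ u} → Reads a u → Reads a′ u → a ≡ a′
  reads-injective (inj₁ (_ , u≡)) (inj₁ (_ , u≡′)) = head-injective (trans (sym u≡) u≡′)
  reads-injective (inj₂ (_ , u≡)) (inj₂ (_ , u≡′)) = tail-injective (trans (sym u≡) u≡′)
  reads-injective (inj₁ (_ , u≡)) (inj₂ (_ , u≡′)) = ⊥-elim (head≢tail (trans (sym u≡) u≡′))
  reads-injective (inj₂ (_ , u≡)) (inj₁ (_ , u≡′)) = ⊥-elim (head≢tail (trans (sym u≡′) u≡))

  L≤d : L ≤ d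
  L≤d = ≤-trans (m≤m+n L (L + 0)) (m≤m+n (2 * L) 1)

  take-track : ∀ δ e → map ψ (take L (track δ e)) ≡ take L (oriented δ e)
  take-track δ e = begin
    map ψ (take L (segment δ e 1 d ++ _))   ≡⟨ cong (map ψ) (take-++ˡ L (segment δ e 1 d) _ (subst (L ≤_) (sym (length-segment δ e 1 d)) L≤d)) ⟩
    map ψ (take L (segment δ e 1 d))        ≡⟨ take-map L (segment δ e 1 d) ⟨
    take L (map ψ (segment δ e 1 d))        ≡⟨ cong (take L) (track-colours δ e) ⟩
    take L (oriented δ e)                   ∎
    where open ≡-Reasoning

  window : ∀ {v ws} → NonBacktracking (orig v ∷ ws) → L ≤ length ws → Reads (c v) (map ψ (take L ws))
  window {v} {[]}     nb L≤ with ≤-antisym L≤ z≤n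
  ... | refl = inj₁ (c v , refl)
  window {v} {y ∷ ws} nb L≤ with leaving-branch d≢0 nb
  ... | δ , e , v≡ , cmp = reads δ v≡ (trans (cong (map ψ) taken) (take-track δ e))
    where
    taken : take L (y ∷ ws) ≡ take L (track δ e)
    taken = comparable-take L cmp L≤ (subst (L ≤_) (sym len) (≤-trans L≤d (n≤1+n d)))
      where
      len : length (track δ e) ≡ suc d
      len = trans (length-++ (segment δ e 1 d)) (trans (cong (_+ 1) (length-segment δ e 1 d)) (+-comm d 1))
    reads : ∀ δ → orig v ≡ position δ e 0 → map ψ (take L (y ∷ ws)) ≡ take L (oriented δ e) → Reads (c v) (map ψ (take L (y ∷ ws)))
    reads forward  refl u≡ = inj₁ (_ , u≡)
    reads backward v≡  u≡ rewrite orig-injective (trans v≡ (along-end e)) = inj₂ (_ , u≡)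

  branches : List V → List (Fin n)
  branches []               = []
  branches (orig v ∷ ws)    = v ∷ branches ws
  branches (inner _ _ ∷ ws) = branches ws

  branches-++ : ∀ xs ys → branches (xs ++ ys) ≡ branches xs ++ branches ys
  branches-++ []               ys = refl
  branches-++ (orig v ∷ xs)    ys = cong (v ∷_) (branches-++ xs ys)
  branches-++ (inner _ _ ∷ xs) ys = branches-++ xs ys

  branches-[] : ∀ ws → branches ws ≡ [] → All IsInner ws
  branches-[] []               _  = []
  branches-[] (inner _ _ ∷ ws) eq = _ ∷ branches-[] ws eq

  first-branch : ∀ ws {v vs} → branches ws ≡ v ∷ vs → ∃₂ λ ms ns → ws ≡ ms ++ orig v ∷ ns × All IsInner ms
  first-branch (orig _ ∷ ws)    refl = [] , ws , refl , []
  first-branch (inner e k ∷ ws) eq with first-branch ws eq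
  ... | ms , ns , refl , ms-inner = inner e k ∷ ms , ns , refl , _ ∷ ms-inner

  branches-linked : ∀ ws → NonBacktracking ws → Linked (Adj G) (branches ws)
  branches-linked []               nb = []
  branches-linked (inner _ _ ∷ ws) nb = branches-linked ws (nonBacktracking-tail nb)
  branches-linked (orig v ∷ ws)    nb with branches ws in eq | branches-linked ws (nonBacktracking-tail nb)
  ... | []     | _      = [-]
  ... | w ∷ _  | linked with first-branch ws eq
  ...   | ms , ns , refl , ms-inner = proj₂ (between-branches d≢0 ms nb) ms-inner ∷ linked

  branches-unique : ∀ ws → Unique ws → Unique (branches ws)
  branches-unique []               []       = []
  branches-unique (inner _ _ ∷ ws) (_ ∷ u)  = branches-unique ws u
  branches-unique (orig v ∷ ws)    (v∉ ∷ u) = avoids ws v∉ ∷ branches-unique ws u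
    where
    avoids : ∀ ws → All (orig v ≢_) ws → All (v ≢_) (branches ws)
    avoids []               []          = []
    avoids (orig w ∷ ws)    (v≢w ∷ v∉) = (v≢w ∘ cong orig) ∷ avoids ws v∉
    avoids (inner _ _ ∷ ws) (_ ∷ v∉)   = avoids ws v∉

  ψ-inner≢0 : ∀ e k → ψ (inner e k) ≢ # 0
  ψ-inner≢0 e k = nth-nonzero (toℕ k) (word-nonzero _ _)

  nb-reverse-to : ∀ xs {v ws} → NonBacktracking (xs ++ orig v ∷ ws) → NonBacktracking (orig v ∷ reverse xs)
  nb-reverse-to xs {v} {ws} nb = subst NonBacktracking (reverse-++ xs (orig v ∷ []))
    (nonBacktracking-reverse ~-sym (nonBacktracking-prefix (xs ++ orig v ∷ []) (subst NonBacktracking (sym (++-assoc xs _ ws)) nb)))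

  colour-behind : ∀ xs v ys zs w us → NonBacktracking (xs ++ orig v ∷ ys ++ zs ++ orig w ∷ us) →
                  length xs ≡ length zs → map ψ xs ≡ map ψ zs → L ≤ length xs → c v ≡ c w
  colour-behind xs v ys zs w us nb |xs|≡|zs| ψxs≡ψzs L≤|xs| =
    reads-injective (window nbv (subst (L ≤_) (sym (length-reverse xs)) L≤|xs|))
      (subst (Reads (c w)) (sym colours≡) (window nbw (subst (L ≤_) (trans |xs|≡|zs| (sym (length-reverse zs))) L≤|xs|)))
    where
    nbv : NonBacktracking (orig v ∷ reverse xs)
    nbv = nb-reverse-to xs nb
    nbw : NonBacktracking (orig w ∷ reverse zs)
    nbw = nb-reverse-to zs (nonBacktracking-suffix (xs ++ orig v ∷ ys) (subst NonBacktracking (sym (++-assoc xs (orig v ∷ ys) _)) nb))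
    colours≡ : map ψ (take L (reverse xs)) ≡ map ψ (take L (reverse zs))
    colours≡ = begin
      map ψ (take L (reverse xs))  ≡⟨ take-map L (reverse xs) ⟨
      take L (map ψ (reverse xs))  ≡⟨ cong (take L) (reverse-map ψ xs) ⟩
      take L (reverse (map ψ xs))  ≡⟨ cong (take L ∘ reverse) ψxs≡ψzs ⟩
      take L (reverse (map ψ zs))  ≡⟨ cong (take L) (reverse-map ψ zs) ⟨
      take L (map ψ (reverse zs))  ≡⟨ take-map L (reverse zs) ⟩
      map ψ (take L (reverse zs))  ∎
      where open ≡-Reasoning

  -- At least d = 2L + 1 vertices separate v from w while zs is shorter than L, so ys has at least L vertices.
  colour-ahead : ∀ xs v ys zs w us → NonBacktracking (xs ++ orig v ∷ ys ++ zs ++ orig w ∷ us) →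
                 length xs ≡ length zs → map ψ ys ≡ map ψ us → ¬ L ≤ length xs → c v ≡ c w
  colour-ahead xs v ys zs w us nb |xs|≡|zs| ψys≡ψus L≰|xs| =
    reads-injective (subst (Reads (c v)) (cong (map ψ) (take-++ˡ L ys _ L≤|ys|)) (window nbv (≤-trans L≤|ys| (length-++-≤ˡ ys))))
      (subst (Reads (c w)) (sym colours≡) (window nbw (subst (L ≤_) |ys|≡|us| L≤|ys|)))
    where
    nbv : NonBacktracking (orig v ∷ ys ++ zs ++ orig w ∷ us)
    nbv = nonBacktracking-suffix xs nb
    nbw : NonBacktracking (orig w ∷ us)
    nbw = nonBacktracking-suffix (xs ++ orig v ∷ ys ++ zs) (subst NonBacktracking regroup nb)
      where
      regroup : xs ++ orig v ∷ ys ++ zs ++ orig w ∷ us ≡ (xs ++ orig v ∷ ys ++ zs) ++ orig w ∷ us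
      regroup = trans (cong (λ t → xs ++ orig v ∷ t) (sym (++-assoc ys zs _))) (sym (++-assoc xs _ _))
    d≤|ys++zs| : d ≤ length ys + length zs
    d≤|ys++zs| = subst (d ≤_) (length-++ ys) (proj₁ (between-branches d≢0 (ys ++ zs)
                   (subst (λ t → NonBacktracking (orig v ∷ t)) (sym (++-assoc ys zs _)) nbv)))
    L≤|ys| : L ≤ length ys
    L≤|ys| = +-cancelʳ-≤ (length zs) L (length ys) (begin
      L + length zs          ≤⟨ +-monoʳ-≤ L (subst (_≤ L) |xs|≡|zs| (<⇒≤ (≰⇒> L≰|xs|))) ⟩
      L + L                  ≤⟨ ≤-trans (≤-reflexive (cong (L +_) (sym (+-identityʳ L)))) (m≤m+n (2 * L) 1) ⟩
      d                      ≤⟨ d≤|ys++zs| ⟩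
      length ys + length zs  ∎)
      where open ≤-Reasoning
    |ys|≡|us| : length ys ≡ length us
    |ys|≡|us| = trans (sym (length-map ψ ys)) (trans (cong length ψys≡ψus) (length-map ψ us))
    colours≡ : map ψ (take L ys) ≡ map ψ (take L us)
    colours≡ = trans (sym (take-map L ys)) (trans (cong (take L) ψys≡ψus) (take-map L us))

  aligned-branch : ∀ xs v ys zs w us → NonBacktracking (xs ++ orig v ∷ ys ++ zs ++ orig w ∷ us) →
                   length xs ≡ length zs → map ψ xs ≡ map ψ zs → map ψ ys ≡ map ψ us → c v ≡ c w
  aligned-branch xs v ys zs w us nb |xs|≡|zs| ψxs≡ψzs ψys≡ψus with L ≤? length xs
  ... | yes L≤|xs| = colour-behind xs v ys zs w us nb |xs|≡|zs| ψxs≡ψzs L≤|xs|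
  ... | no  L≰|xs| = colour-ahead  xs v ys zs w us nb |xs|≡|zs| ψys≡ψus L≰|xs|

  aligned-branches : ∀ xs ys zs us → NonBacktracking (xs ++ ys ++ zs ++ us) → length xs ≡ length zs →
                     map ψ xs ≡ map ψ zs → map ψ ys ≡ map ψ us → map c (branches ys) ≡ map c (branches us)
  aligned-step : ∀ xs y ys zs u us → NonBacktracking (xs ++ y ∷ ys ++ zs ++ u ∷ us) → length xs ≡ length zs →
                 map ψ xs ≡ map ψ zs → ψ y ≡ ψ u → map ψ ys ≡ map ψ us → map c (branches ys) ≡ map c (branches us)

  aligned-branches xs []       zs []       nb _ _ _ = refl
  aligned-branches xs (orig v ∷ ys) zs (orig w ∷ us) nb |xs|≡ ψxs≡ ψys≡ =
    cong₂ _∷_ (aligned-branch xs v ys zs w us nb |xs|≡ ψxs≡ (∷-injectiveʳ ψys≡))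
              (aligned-step xs (orig v) ys zs (orig w) us nb |xs|≡ ψxs≡ refl (∷-injectiveʳ ψys≡))
  aligned-branches xs (inner e k ∷ ys) zs (inner e′ k′ ∷ us) nb |xs|≡ ψxs≡ ψys≡ =
    aligned-step xs (inner e k) ys zs (inner e′ k′) us nb |xs|≡ ψxs≡ (∷-injectiveˡ ψys≡) (∷-injectiveʳ ψys≡)
  aligned-branches xs (orig v ∷ ys) zs (inner e′ k′ ∷ us) nb _ _ ψys≡ = ⊥-elim (ψ-inner≢0 e′ k′ (sym (∷-injectiveˡ ψys≡)))
  aligned-branches xs (inner e k ∷ ys) zs (orig w ∷ us) nb _ _ ψys≡ = ⊥-elim (ψ-inner≢0 e k (∷-injectiveˡ ψys≡))

  aligned-step xs y ys zs u us nb |xs|≡ ψxs≡ ψy≡ ψys≡ = aligned-branches (xs ++ y ∷ []) ys (zs ++ u ∷ []) us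
    (subst NonBacktracking regroup nb)
    (trans (length-++ xs) (trans (cong (_+ 1) |xs|≡) (sym (length-++ zs))))
    (trans (map-++ ψ xs _) (trans (cong₂ _++_ ψxs≡ (cong (_∷ []) ψy≡)) (sym (map-++ ψ zs _))))
    ψys≡
    where
    regroup : xs ++ y ∷ ys ++ zs ++ u ∷ us ≡ (xs ++ y ∷ []) ++ ys ++ (zs ++ u ∷ []) ++ us
    regroup = trans (cong (λ t → xs ++ y ∷ ys ++ t) (sym (++-assoc zs (u ∷ []) us))) (sym (++-assoc xs (y ∷ []) _))

  oriented-squareFree : ∀ δ e → SquareFree (oriented δ e)
  oriented-squareFree forward  e = word-squareFree _ _
  oriented-squareFree backward e = squareFree-reverse (word-squareFree _ _)

  inner-square : ∀ y ys zs → NonBacktracking (y ∷ ys ++ zs) → All IsInner (y ∷ ys ++ zs) → map ψ (y ∷ ys) ≢ map ψ zs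
  inner-square y ys zs nb ins ψ≡ with inner-walk-infix (ys ++ zs) nonempty nb ins
    where
    nonempty : ys ++ zs ≢ []
    nonempty ys++zs≡[] = nonnil (trans ψ≡ (cong (map ψ) (++-conicalʳ ys zs ys++zs≡[])))
      where nonnil : map ψ (y ∷ ys) ≢ []
            nonnil ()
  ... | δ , e , us , vs , segment≡ with oriented-squareFree δ e (map ψ us) (map ψ (y ∷ ys)) (map ψ vs) (begin
      oriented δ e                                         ≡⟨ track-colours δ e ⟨
      map ψ (segment δ e 1 d)                              ≡⟨ cong (map ψ) segment≡ ⟩
      map ψ (us ++ (y ∷ ys ++ zs) ++ vs)                    ≡⟨ map-++ ψ us _ ⟩
      map ψ us ++ map ψ ((y ∷ ys ++ zs) ++ vs)              ≡⟨ cong (map ψ us ++_) (map-++ ψ (y ∷ ys ++ zs) vs) ⟩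
      map ψ us ++ map ψ (y ∷ ys ++ zs) ++ map ψ vs          ≡⟨ cong (λ t → map ψ us ++ t ++ map ψ vs) (map-++ ψ (y ∷ ys) zs) ⟩
      map ψ us ++ (map ψ (y ∷ ys) ++ map ψ zs) ++ map ψ vs  ≡⟨ cong (λ t → map ψ us ++ (map ψ (y ∷ ys) ++ t) ++ map ψ vs) (sym ψ≡) ⟩
      map ψ us ++ (map ψ (y ∷ ys) ++ map ψ (y ∷ ys)) ++ map ψ vs ≡⟨ cong (map ψ us ++_) (++-assoc (map ψ (y ∷ ys)) _ _) ⟩
      map ψ us ++ map ψ (y ∷ ys) ++ map ψ (y ∷ ys) ++ map ψ vs ∎)
    where open ≡-Reasoning
  ... | ()

  inner-transfer : ∀ ys zs → All IsInner ys → map ψ ys ≡ map ψ zs → All IsInner zs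
  inner-transfer []               []                _          _   = []
  inner-transfer (_ ∷ ys)         (inner _ _ ∷ zs)  (_ ∷ ins)  eq  = _ ∷ inner-transfer ys zs ins (∷-injectiveʳ eq)
  inner-transfer (inner e k ∷ ys) (orig _ ∷ zs)     _          eq  = ⊥-elim (ψ-inner≢0 e k (∷-injectiveˡ eq))
  inner-transfer (orig _ ∷ ys)    (orig _ ∷ zs)     (() ∷ _)   _

  ψ-nonrepetitive : Nonrepetitive (Adj G) c → Nonrepetitive _~_ ψ
  ψ-nonrepetitive c-nonrep ws path (ys , zs , refl , ys≢[] , ψys≡ψzs) with branches ys in eq
  ... | [] = without-branches ys ys≢[] path ψys≡ψzs (branches-[] ys eq)
    where
    without-branches : ∀ ys → ys ≢ [] → IsPath _~_ (ys ++ zs) → map ψ ys ≡ map ψ zs → All IsInner ys → ⊥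
    without-branches []       ys≢[] _    _   _   = ys≢[] refl
    without-branches (y ∷ ys) _     path ψ≡  ins =
      inner-square y ys zs (path⇒nonBacktracking path) (++⁺ ins (inner-transfer (y ∷ ys) zs ins ψ≡)) ψ≡
  ... | v ∷ vs = c-nonrep (branches (ys ++ zs))
      (branches-unique (ys ++ zs) (proj₁ path) , branches-linked (ys ++ zs) (path⇒nonBacktracking path))
      ( branches ys , branches zs , branches-++ ys zs , (λ ys≡[] → []≢∷ (trans (sym ys≡[]) eq))
      , aligned-branches [] ys [] zs (path⇒nonBacktracking path) refl refl ψys≡ψzs)
    where
    []≢∷ : ∀ {v : Fin n} {vs : List (Fin n)} → [] ≢ v ∷ vs
    []≢∷ ()

-- Choosing the code length

n≤⌈n/2⌉+⌈n/2⌉ : ∀ n → n ≤ ⌈ n /2⌉ + ⌈ n /2⌉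
n≤⌈n/2⌉+⌈n/2⌉ n = subst (_≤ ⌈ n /2⌉ + ⌈ n /2⌉) (⌊n/2⌋+⌈n/2⌉≡n n) (+-monoˡ-≤ ⌈ n /2⌉ (⌊n/2⌋≤⌈n/2⌉ n))

n≤2^⌈log₂n⌉ : ∀ n → n ≤ 2 ^ ⌈log₂ n ⌉
n≤2^⌈log₂n⌉ = <-rec (λ n → n ≤ 2 ^ ⌈log₂ n ⌉) step
  where
  step : ∀ n → (∀ {m} → m < n → m ≤ 2 ^ ⌈log₂ m ⌉) → n ≤ 2 ^ ⌈log₂ n ⌉
  step zero          _   = z≤n
  step (suc zero)    _   = s≤s z≤n
  step n@(suc (suc m)) rec = begin
    n                                    ≤⟨ n≤⌈n/2⌉+⌈n/2⌉ n ⟩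
    ⌈ n /2⌉ + ⌈ n /2⌉                    ≤⟨ +-mono-≤ half≤ half≤ ⟩
    2 ^ (ℓ ∸ 1) + 2 ^ (ℓ ∸ 1)            ≡⟨ 2^suc (ℓ ∸ 1) ⟨
    2 ^ suc (ℓ ∸ 1)                      ≡⟨ cong (2 ^_) (m+[n∸m]≡n 1≤ℓ) ⟩
    2 ^ ℓ                                ∎
    where
    open ≤-Reasoning
    ℓ = ⌈log₂ n ⌉
    1≤ℓ : 1 ≤ ℓ
    1≤ℓ = subst (_≤ ℓ) (⌈log₂2^n⌉≡n 1) (⌈log₂⌉-mono-≤ {2} {n} (s≤s (s≤s z≤n)))
    half≤ : ⌈ n /2⌉ ≤ 2 ^ (ℓ ∸ 1)
    half≤ = subst (λ k → ⌈ n /2⌉ ≤ 2 ^ k) (⌈log₂⌈n/2⌉⌉≡⌈log₂n⌉∸1 n) (rec (⌈n/2⌉<n m))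

-- If 2 ^ r < p then 2 ^ (4 + 3r) = 16 (2 ^ r)³ < 16 p³ ≤ p ^ 17.
p≤2^r : ∀ p r → 2 ≤ p → p ^ 17 ≤ 2 ^ (4 + 3 * r) → p ≤ 2 ^ r
p≤2^r p r 2≤p p¹⁷≤ with p ≤? 2 ^ r
... | yes p≤ = p≤
... | no  p≰ = ⊥-elim (<-irrefl refl (begin-strict
  p ^ 17                  ≤⟨ p¹⁷≤ ⟩
  2 ^ (4 + 3 * r)         ≡⟨ ^-distribˡ-+-* 2 4 (3 * r) ⟩
  16 * 2 ^ (3 * r)        ≡⟨ cong (λ k → 16 * 2 ^ k) (*-comm 3 r) ⟩
  16 * 2 ^ (r * 3)        ≡⟨ cong (16 *_) (^-*-assoc 2 r 3) ⟨
  16 * (2 ^ r) ^ 3        <⟨ *-monoʳ-< 16 (^-monoˡ-< 3 (≰⇒> p≰)) ⟩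
  16 * p ^ 3              ≤⟨ *-monoˡ-≤ (p ^ 3) (≤-trans (^-monoʳ-≤ 2 {4} {14} (s≤s (s≤s (s≤s (s≤s z≤n))))) (^-monoˡ-≤ 14 2≤p)) ⟩
  p ^ 14 * p ^ 3          ≡⟨ ^-distribˡ-+-* p 14 3 ⟨
  p ^ 17                  ∎))
  where open ≤-Reasoning

log₂p¹⁷-split : ∀ p → 2 ≤ p → ∃₂ λ r q → ⌈log₂ (p ^ 17) ⌉ ≡ 2 + (3 * r + q) × p ≤ 2 ^ r
log₂p¹⁷-split p 2≤p = r , q , ℓ≡ , p≤2^r p r 2≤p (begin
  p ^ 17                ≤⟨ n≤2^⌈log₂n⌉ (p ^ 17) ⟩
  2 ^ ℓ                 ≤⟨ ^-monoʳ-≤ 2 ℓ≤ ⟩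
  2 ^ (4 + 3 * r)       ∎)
  where
  open ≤-Reasoning
  ℓ = ⌈log₂ (p ^ 17) ⌉
  2≤ℓ : 2 ≤ ℓ
  2≤ℓ = subst (_≤ ℓ) (⌈log₂2^n⌉≡n 2) (⌈log₂⌉-mono-≤ (≤-trans (^-monoʳ-≤ 2 {2} {17} (s≤s (s≤s z≤n))) (^-monoˡ-≤ 17 2≤p)))
  r = (ℓ ∸ 2) / 3
  q = (ℓ ∸ 2) % 3
  ℓ≡ : ℓ ≡ 2 + (3 * r + q)
  ℓ≡ = trans (sym (m+[n∸m]≡n 2≤ℓ)) (cong (2 +_) (trans (m≡m%n+[m/n]*n (ℓ ∸ 2) 3) (lemma q r)))
    where lemma : ∀ q r → q + r * 3 ≡ 3 * r + q
          lemma = solve-∀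
  ℓ≤ : ℓ ≤ 4 + 3 * r
  ℓ≤ = begin
    ℓ                   ≡⟨ ℓ≡ ⟩
    2 + (3 * r + q)     ≤⟨ +-monoʳ-≤ 2 (+-monoʳ-≤ (3 * r) (≤-pred (m%n<n (ℓ ∸ 2) 3))) ⟩
    2 + (3 * r + 2)     ≡⟨ cong (2 +_) (+-comm (3 * r) 2) ⟩
    4 + 3 * r           ∎

subdivision-colouring : ∀ {n} (G : Graph n) {p L} → EdgeWords p L → (c : Fin n → Fin p) → Nonrepetitive (Adj G) c →
                        HasNonrepColouring (SubAdj G (2 * L + 1)) 5
subdivision-colouring G W c c-nonrep = ψ , ψ-nonrepetitive c-nonrep
  where open SubdivisionColouring G W c

arc-edge : ∀ {n} {G : Graph n} {d x y} → SubArc G d x y → Edge G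
arc-edge (direct e _)     = e
arc-edge (first e _ _)    = e
arc-edge (middle e _ _ _) = e
arc-edge (last e _ _)     = e

-- With at most one colour the edge u v would be a repetitively coloured path.
edgeless : ∀ {n} (G : Graph n) {p} (c : Fin n → Fin p) → Nonrepetitive (Adj G) c → p ≤ 1 → ¬ Edge G
edgeless G c c-nonrep p≤1 (u , v , u<v , u~v) =
  c-nonrep (u ∷ v ∷ []) (((λ u≡v → <-irrefl (cong toℕ u≡v) u<v) ∷ []) ∷ [] ∷ [] , u~v ∷ [-])
    (u ∷ [] , v ∷ [] , refl , (λ ()) , cong (_∷ []) (toℕ-injective (trans (zero′ (c u)) (sym (zero′ (c v))))))
  where
  zero′ : ∀ a → toℕ a ≡ 0
  zero′ a = n≤0⇒n≡0 (≤-pred (<-≤-trans (toℕ<n a) p≤1))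

edgeless-nonrepetitive : ∀ {n} (G : Graph n) → ¬ Edge G → ∀ d {C} (φ : SubV G d → C) → Nonrepetitive (SubAdj G d) φ
edgeless-nonrepetitive G no-edge d φ (x ∷ y ∷ _) (_ , x~y ∷ _) _ = no-edge (edge x~y)
  where
  edge : ∀ {x y} → SubAdj G d x y → Edge G
  edge (inj₁ a) = arc-edge a
  edge (inj₂ a) = arc-edge a
edgeless-nonrepetitive G no-edge d φ []          _ ([] , [] , _ , ys≢[] , _) = ys≢[] refl
edgeless-nonrepetitive G no-edge d φ (x ∷ [])    _ ([] , _ , _ , ys≢[] , _) = ys≢[] refl
edgeless-nonrepetitive G no-edge d φ (x ∷ [])    _ (_ ∷ [] , [] , _ , _ , ())
edgeless-nonrepetitive G no-edge d φ (x ∷ [])    _ (_ ∷ [] , _ ∷ _ , () , _ , _)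
edgeless-nonrepetitive G no-edge d φ (x ∷ [])    _ (_ ∷ _ ∷ _ , _ , () , _ , _)

theorem91 : (n : ℕ) (G : Graph n) (p : ℕ) → IsPi (Adj G) p →
    HasNonrepColouring (SubAdj G (2 * ⌈log₂ (p ^ 17) ⌉ + 1)) 5
theorem91 n G p ((c , c-nonrep) , _) = colouring (2 ≤? p)
  where
  colouring : Dec (2 ≤ p) → HasNonrepColouring (SubAdj G (2 * ⌈log₂ (p ^ 17) ⌉ + 1)) 5
  colouring (no 2≰p) =
    (λ _ → # 0) , edgeless-nonrepetitive G (edgeless G c c-nonrep (≤-pred (≰⇒> 2≰p))) _ (λ _ → # 0)
  colouring (yes 2≤p) = from-split (log₂p¹⁷-split p 2≤p)
    where
    from-split : ∃₂ (λ r q → ⌈log₂ (p ^ 17) ⌉ ≡ 2 + (3 * r + q) × p ≤ 2 ^ r) →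
                 HasNonrepColouring (SubAdj G (2 * ⌈log₂ (p ^ 17) ⌉ + 1)) 5
    from-split (r , q , ℓ≡ , p≤2^r) = subst (λ ℓ → HasNonrepColouring (SubAdj G (2 * ℓ + 1)) 5) (sym ℓ≡)
      (subdivision-colouring G (thueMorseEdgeWords r q p≤2^r) c c-nonrep)
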